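{- Let $G=(V,E)$ be a finite simple undirected graph in which every node has even degree, and run algorithm Euler-Tour on a stream of its edges, finding the cycles $C_1,\ldots,C_N$ in chronological order. Let $k\in\{0,\ldots,N\}$. Then $\delta^*_k$ is bijective, and for any $(u,v),(u',v')\in R^*(E)$: (i) if $(u,v)$ and $(u',v')$ are processed edges after step $k$, then $(u,v)\equiv_{\delta^*_k}(u',v')$ if and only if $t_k(u)=t_k(u')$; (ii) if $(u,v)$ is a processed edge after step $k$, then $t_k(u)=t_k(v)$; (iii) if $t_k(u)=0$, then $(u,v)\equiv_{\delta^*_k}(u',v')$ if and only if $(u,v)\equiv_{\delta^c}(u',v')$.
   Context: Setting: $G=(V,E)$ is a finite simple undirected graph, streamed edge by edge, each edge read once in arbitrary order. Algorithm Euler-Tour. Initialize $c:=0$, $F:=\emptyset$ (a set of directed edges), $E_{\mathrm{int}}:=\emptyset$, and $j(v):=0$, $t(v):=0$ for all $v\in V$. Output consists of triples $(v_1,v_2,s)$, meaning $(v_2,s)$ is marked as successor of $(v_1,v_2)$. Main loop: for each streamed edge $e$, add it to $E_{\mathrm{int}}$. If $(V,E_{\mathrm{int}})$ contains a cycle $C$, call Merge-Cycle$(C)$ with $C$ given as an ordered cycle $(v_1,\ldots,v_k)$, indices cyclic. Merge-Cycle performs the following steps in order. 1. For $i=1,\ldots,k$: if $t(v_i)=0$, set $j(v_i):=v_{i+1}$ and add $(v_{i-1},v_i)$ to $F$. 2. Set $M:=\emptyset$ and $J:=\emptyset$. For each $j=1,\ldots,|V|$: if some $v_i$ has $t(v_i)=j$,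 add exactly one such $v_i$ to $J$ and add $j$ to $M$. 3. For each $v_i\in J$: write $(v_{i-1},v_i,j(v_i))$, then set $j(v_i):=v_{i+1}$. 4. For each edge $(v_i,v_{i+1})$ of $C$ neither written nor added to $F$: write $(v_i,v_{i+1},v_{i+2})$. 5. If $M=\emptyset$, set $c:=c+1$ and $a:=c$; otherwise set $a:=\min M$. For each $v$ with $t(v)\in M$, set $t(v):=a$. For all $i$, set $t(v_i):=a$. 6. Delete the edges of $C$ from $E_{\mathrm{int}}$. At the end, for each $(u,v)\in F$, the triple $(u,v,j(v))$ is written. Notation: - For a variable $x$, $x_k$ denotes its value after the $k$-th call of Merge-Cycle ($x_0$ is the initial value). - $R^*(E)$ is the set of directed edges $(u,v)$ for which a triple $(u,v,s)$ is written. It contains exactly one orientation of each edge and equals $\bigcup_i E(C_i)$, where $E(C_i)$ is the set of directed edges of the ordered cycle $C_i$. - $\delta^c$ maps each directed edge $(v_j,v_{j+1})$ of an ordered cycle $C_i=(v_1,\ldots,v_{\ell_i})$ to $(v_{j+1},v_{j+2})$. - The processed edges after step $k$ are those in $\bigcup_{i\le k}E(C_i)$. Each is either of type A (written with some successor $e'$) or of type B (in $F_k$). - $\delta_k$ maps a type A edge $(u,v)$ to its written successor $e'$ and a type B edge $(u,v)$ to $(v,j_k(v))$. - $\delta^*_k$ equals $\delta_k$ on $\bigcup_{i\le k}E(C_i)$ and $\delta^c$ on $\bigcup_{i>k}E(C_i)$. - For a successor function $\delta$, $x\equiv_\delta x'$ means $\delta^m(x)=x'$ for some $m\in\mathbb{N}=\{1,2,\ldots\}$.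 -}

module Defs where

open import Level using (0ℓ)
open import Data.Nat using (ℕ; zero; suc; _+_; _≤_; _<_; _≤ᵇ_; _≡ᵇ_; _⊓_)
open import Data.Nat.Divisibility using (_∣_)
open import Data.Fin using (Fin; zero; suc; toℕ; fromℕ; fromℕ<; inject₁)
open import Data.Fin.Properties using (_≟_)
open import Data.Bool using (Bool; true; false; if_then_else_; _∧_; _∨_)
open import Data.Maybe using (Maybe; just; nothing; is-just)
import Data.Maybe as Maybe
open import Data.List using (List; []; _∷_; take; drop; map)
open import Data.List.Relation.Unary.All using (All)
open import Data.List.Relation.Unary.Any using (Any)
open import Data.List.Relation.Unary.AllPairs using (AllPairs)
open import Data.Product using (Σ; ∃; _×_; _,_; proj₁; proj₂)
open import Data.Sum using (_⊎_)
open import Data.Empty using (⊥)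
open import Relation.Nullary using (¬_; yes; no; does)
open import Relation.Binary.PropositionalEquality using (_≡_; _≢_)
open import Function using (_∘_; _⇔_)
open import Function.Definitions using (Injective)
import Data.Nat as ℕ

DEdge : ℕ → Set
DEdge n = Fin n × Fin n

SameEdge : ∀ {n} → DEdge n → DEdge n → Set
SameEdge (a , b) (c , d) = (a ≡ c × b ≡ d) ⊎ (a ≡ d × b ≡ c)

-- The stream: a list of edges, each edge of G appearing exactly once.
-- G = (Fin n, set of edges of the stream) is simple: no loops, no
-- repeated (undirected) edges.
SimpleStream : ∀ {n} → List (DEdge n) → Set
SimpleStream es = All (λ e → proj₁ e ≢ proj₂ e) es
                × AllPairs (λ e e' → ¬ SameEdge e e') es

deg : ∀ {n} → Fin n → List (DEdge n) → ℕ
deg v [] = 0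
deg v ((a , b) ∷ es) =
  (if does (v ≟ a) then 1 else 0) + (if does (v ≟ b) then 1 else 0) + deg v es

next : ∀ {k} → Fin k → Fin k
next {suc k} i with toℕ i ℕ.<? k
... | yes p = suc (fromℕ< p)
... | no _ = zero

prev : ∀ {k} → Fin k → Fin k
prev {suc k} zero = fromℕ k
prev {suc k} (suc i) = inject₁ i

-- An ordered cycle (v_1, ..., v_len) : distinct vertices, len ≥ 3,
-- indices taken cyclically (positions 0 .. len-1).
record OrdCycle (n : ℕ) : Set where
  field
    len    : ℕ
    len≥3  : 3 ≤ len
    vtx    : Fin len → Fin n
    vtxInj : Injective _≡_ _≡_ vtx
open OrdCycle public

CEdge : ∀ {n} → OrdCycle n → DEdge n → Set
CEdge C (x , y) = Σ (Fin (len C)) λ i → vtx C i ≡ x × vtx C (next i) ≡ y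

CSucc : ∀ {n} → OrdCycle n → DEdge n → DEdge n → Set
CSucc C e e' = Σ (Fin (len C)) λ i →
  e ≡ (vtx C i , vtx C (next i)) × e' ≡ (vtx C (next i) , vtx C (next (next i)))

record State (n : ℕ) : Set₁ where
  field
    c    : ℕ
    F    : Fin n → Fin n → Set
    Eint : Fin n → Fin n → Set                   -- symmetric: undirected edges
    j    : Fin n → Maybe (Fin n)                 -- nothing encodes the initial value 0
    t    : Fin n → ℕ
    W    : Fin n → Fin n → Maybe (Fin n) → Set   -- triples written so far
open State public

initState : (n : ℕ) → State n
initState n = record
  { c = 0 ; F = λ _ _ → ⊥ ; Eint = λ _ _ → ⊥
  ; j = λ _ → nothing ; t = λ _ → 0 ; W = λ _ _ _ → ⊥ }

addEdge : ∀ {n} → DEdge n → State n → State n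
addEdge e S = record S { Eint = λ x y → Eint S x y ⊎ SameEdge (x , y) e }

IsCycleIn : ∀ {n} → (Fin n → Fin n → Set) → OrdCycle n → Set
IsCycleIn E C = ∀ i → E (vtx C i) (vtx C (next i))

findPos : ∀ {L n} → (Fin L → Fin n) → Fin n → Maybe (Fin L)
findPos {zero} f v = nothing
findPos {suc L} f v with f zero ≟ v
... | yes _ = just zero
... | no _ = Maybe.map suc (findPos (f ∘ suc) v)

anyFin : ∀ {L} → (Fin L → Bool) → Bool
anyFin {zero} p = false
anyFin {suc L} p = p zero ∨ anyFin (p ∘ suc)

minOpt : Maybe ℕ → Maybe ℕ → Maybe ℕ
minOpt nothing y = y
minOpt (just x) nothing = just x
minOpt (just x) (just y) = just (x ⊓ y)

minFin : ∀ {L} → (Fin L → Maybe ℕ) → Maybe ℕ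
minFin {zero} f = nothing
minFin {suc L} f = minOpt (f zero) (minFin (f ∘ suc))

module Merge {n : ℕ} (S : State n) (C : OrdCycle n) where
  P : Fin (len C) → Fin n
  P = vtx C

  inRange : ℕ → Bool
  inRange x = (1 ≤ᵇ x) ∧ (x ≤ᵇ n)

  inM : ℕ → Bool
  inM x = inRange x ∧ anyFin (λ i → t S (P i) ≡ᵇ x)

  minM : Maybe ℕ
  minM = minFin (λ i → if inRange (t S (P i)) then just (t S (P i)) else nothing)

  -- valid choices of J (step 2), given as indicator on cycle positions
  ValidJ : (Fin (len C) → Bool) → Set
  ValidJ ch =
      (∀ i → ch i ≡ true → 1 ≤ t S (P i) × t S (P i) ≤ n)
    × (∀ i → 1 ≤ t S (P i) → t S (P i) ≤ n →
         Σ (Fin (len C)) λ i' → ch i' ≡ true × t S (P i') ≡ t S (P i)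
           × (∀ i'' → ch i'' ≡ true → t S (P i'') ≡ t S (P i) → i'' ≡ i'))

  j₁ : Fin n → Maybe (Fin n)
  j₁ v with findPos P v
  ... | nothing = j S v
  ... | just i = if t S (P i) ≡ᵇ 0 then just (P (next i)) else j S v

  merge : (Fin (len C) → Bool) → State n
  merge ch = record
    { c = newc
    ; F = λ x y → F S x y ⊎
            (Σ (Fin (len C)) λ i → t S (P i) ≡ 0 × x ≡ P (prev i) × y ≡ P i)
    ; Eint = λ x y → Eint S x y × ¬ CEdge C (x , y) × ¬ CEdge C (y , x)
    ; j = j₂
    ; t = t'
    ; W = λ x y s → W S x y s
            ⊎ (Σ (Fin (len C)) λ i → ch i ≡ true
                 × x ≡ P (prev i) × y ≡ P i × s ≡ j₁ (P i))
            ⊎ (Σ (Fin (len C)) λ i → ch (next i) ≡ false × t S (P (next i)) ≢ 0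
                 × x ≡ P i × y ≡ P (next i) × s ≡ just (P (next (next i))))
    }
    where
    j₂ : Fin n → Maybe (Fin n)
    j₂ v with findPos P v
    ... | nothing = j₁ v
    ... | just i = if ch i then just (P (next i)) else j₁ v
    newc : ℕ
    newc with minM
    ... | nothing = suc (c S)
    ... | just _ = c S
    a : ℕ
    a with minM
    ... | nothing = suc (c S)
    ... | just m = m
    t' : Fin n → ℕ
    t' v = if is-just (findPos P v) ∨ inM (t S v) then a else t S v

-- Exec S es tr : starting from S and
-- streaming es, the successive calls of Merge-Cycle are on the cycles
-- listed in tr, each paired with the state right after that call.

data Exec {n : ℕ} : State n → List (DEdge n) → List (OrdCycle n × State n) → Set₁ where
  done  : ∀ {S} → Exec S [] []
  noCyc : ∀ {S e es tr} →
          ¬ (Σ (OrdCycle n) λ C → IsCycleIn (Eint (addEdge e S)) C) →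
          Exec (addEdge e S) es tr → Exec S (e ∷ es) tr
  cyc   : ∀ {S e es tr} (C : OrdCycle n) (ch : Fin (len C) → Bool) →
          IsCycleIn (Eint (addEdge e S)) C →
          Merge.ValidJ (addEdge e S) C ch →
          Exec (Merge.merge (addEdge e S) C ch) es tr →
          Exec S (e ∷ es) ((C , Merge.merge (addEdge e S) C ch) ∷ tr)

-- state after the k-th call of Merge-Cycle (x_k); k = 0 gives S₀
stateAt : ∀ {n} → State n → List (OrdCycle n × State n) → ℕ → State n
stateAt S [] k = S
stateAt S (_ ∷ _) zero = S
stateAt S ((_ , S') ∷ tr) (suc k) = stateAt S' tr k

OnCycles : ∀ {n} → List (OrdCycle n × State n) → DEdge n → Set
OnCycles cs e = Any (λ C → CEdge C e) (map proj₁ cs)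

RStar : ∀ {n} → List (OrdCycle n × State n) → DEdge n → Set
RStar tr = OnCycles tr

Processed : ∀ {n} → List (OrdCycle n × State n) → ℕ → DEdge n → Set
Processed tr k = OnCycles (take k tr)

DeltaC : ∀ {n} → List (OrdCycle n × State n) → DEdge n → DEdge n → Set
DeltaC cs e e' = Any (λ C → CSucc C e e') (map proj₁ cs)

-- δ_k (relation): type A edges go to their written successor,
-- type B edges (u,v) ∈ F_k go to (v, j_k(v)).
Delta : ∀ {n} → State n → DEdge n → DEdge n → Set
Delta S (u , v) (v' , s) =
  v' ≡ v × (W S u v (just s) ⊎ (F S u v × j S v ≡ just s))

DeltaStar : ∀ {n} → State n → List (OrdCycle n × State n) → ℕ →
            DEdge n → DEdge n → Set
DeltaStar S₀ tr k e e' =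
    (Processed tr k e × Delta (stateAt S₀ tr k) e e')
  ⊎ (OnCycles (drop k tr) e × DeltaC (drop k tr) e e')

BijectiveOn : ∀ {A : Set} → (A → Set) → (A → A → Set) → Set
BijectiveOn {A} P R =
    (∀ x → P x → Σ A λ y → P y × R x y × (∀ y' → R x y' → y' ≡ y))
  × (∀ y → P y → Σ A λ x → P x × R x y × (∀ x' → P x' → R x' y → x' ≡ x))

data Iter {A : Set} (R : A → A → Set) : ℕ → A → A → Set where
  iter0 : ∀ {x} → Iter R 0 x x
  iterS : ∀ {m x y z} → R x y → Iter R m y z → Iter R (suc m) x z

EquivBy : ∀ {A : Set} → (A → A → Set) → A → A → Set
EquivBy R x x' = Σ ℕ λ m → Iter R (suc m) x x'

module Submission where

-- Write δ* for the successor relation that is δ_k on processed edges and δ^c on the cycles still to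
-- come.  Initially δ* = δ^c, a bijection because the cycles found are edge-disjoint.  A call of
-- Merge-Cycle on C changes δ* only by precomposition with an involution τ: for each v_i ∈ J, the
-- cycle edge (v_{i-1}, v_i) and the unique F-edge into v_i exchange their successors.  Hence δ*
-- stays a bijection, and since exchanging the successors of two edges in different orbits merges
-- the orbits, C is spliced into every class of processed edges whose label occurs on C; these
-- classes all receive the label a, while the other classes keep both labels and successors.  This
-- is maintained as an invariant along the execution, together with the bookkeeping that every
-- labelled vertex has exactly one incoming F-edge, that F-edges are never written, and that at most
-- |V| labels are in use.  It gives (i) and (ii); an edge whose tail has label 0 lies on a later
-- cycle, where δ* is δ^c, whence (iii).

open import Defs
open import Data.Nat using (ℕ; _≤_)
open import Data.Nat.Divisibility using (_∣_)
open import Data.Fin using (Fin)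
open import Data.List using (List; length)
open import Data.Product using (Σ; _×_; _,_)
open import Relation.Binary.PropositionalEquality using (_≡_)
open import Function using (_⇔_)

open import Data.Nat using (zero; suc; _+_; _∸_; _<_; _≤ᵇ_; _≡ᵇ_; z≤n; s≤s)
import Data.Nat.Properties as ℕ
open import Data.Fin using (zero; suc; toℕ; fromℕ; fromℕ<; inject₁)
import Data.Fin.Properties as Fin
open import Data.Bool using (Bool; true; false; if_then_else_; _∧_; _∨_; T)
open import Data.Bool.Properties using (T-≡)
open import Data.Maybe using (Maybe; just; nothing; is-just)
open import Data.Maybe.Properties using (just-injective)
open import Data.List using ([]; _∷_; map; take; drop; _++_)
open import Data.List.Properties using (map-++; take++drop≡id; ++-identityʳ; ++-assoc)
open import Data.List.Membership.Propositional using (_∈_)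
open import Data.List.Relation.Unary.All as All using (All; _∷_)
open import Data.List.Relation.Unary.All.Properties using (All¬⇒¬Any)
open import Data.List.Relation.Unary.Any as Any using (Any; here; there)
import Data.List.Relation.Unary.Any.Properties as Any
open import Data.List.Relation.Unary.AllPairs using (AllPairs; []; _∷_)
open import Data.Product using (proj₁; proj₂)
open import Data.Product.Properties using (×-≡,≡←≡; ≡-dec)
open import Data.Sum using (_⊎_; inj₁; inj₂; map₂)
open import Data.Empty using (⊥-elim)
open import Relation.Nullary using (¬_; yes; no; Dec)
open import Relation.Binary.PropositionalEquality
  using (refl; sym; trans; cong; cong₂; subst; subst₂; _≢_; module ≡-Reasoning)
open import Function using (_∘_; mk⇔; Equivalence)
open import Function.Definitions using (Injective)

_≟E_ : ∀ {n} (x y : DEdge n) → Dec (x ≡ y)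
_≟E_ = ≡-dec Fin._≟_ Fin._≟_

next-prev : ∀ {L} (i : Fin L) → next (prev i) ≡ i
next-prev {suc k} zero with toℕ (fromℕ k) ℕ.<? k
... | yes p = ⊥-elim (ℕ.n≮n k (subst (_< k) (Fin.toℕ-fromℕ k) p))
... | no _ = refl
next-prev {suc k} (suc i) with toℕ (inject₁ i) ℕ.<? k
... | yes p = cong suc (Fin.toℕ-injective (trans (Fin.toℕ-fromℕ< p) (Fin.toℕ-inject₁ i)))
... | no p≮ = ⊥-elim (p≮ (subst (_< k) (sym (Fin.toℕ-inject₁ i)) (Fin.toℕ<n i)))

prev-next : ∀ {L} (i : Fin L) → prev (next i) ≡ i
prev-next {suc k} i with toℕ i ℕ.<? k
... | yes p = Fin.toℕ-injective (trans (Fin.toℕ-inject₁ (fromℕ< p)) (Fin.toℕ-fromℕ< p))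
... | no p≮ = Fin.toℕ-injective (trans (Fin.toℕ-fromℕ k)
    (ℕ.≤-antisym (ℕ.≮⇒≥ p≮) (ℕ.≤-pred (Fin.toℕ<n i))))

next-injective : ∀ {L} → Injective _≡_ _≡_ (next {L})
next-injective {_} {i} {j} e = trans (sym (prev-next i)) (trans (cong prev e) (prev-next j))

toℕ-next : ∀ {k} (i : Fin (suc k)) → toℕ i < k → toℕ (next i) ≡ suc (toℕ i)
toℕ-next {k} i i<k with toℕ i ℕ.<? k
... | yes p = cong suc (Fin.toℕ-fromℕ< p)
... | no p≮ = ⊥-elim (p≮ i<k)

next-fromℕ : ∀ k → next (fromℕ k) ≡ zero
next-fromℕ k with toℕ (fromℕ k) ℕ.<? k
... | yes p = ⊥-elim (ℕ.n≮n k (subst (_< k) (Fin.toℕ-fromℕ k) p))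
... | no _ = refl

Star : {A : Set} → (A → A → Set) → A → A → Set
Star R x y = Σ ℕ λ m → Iter R m x y

module _ {A : Set} {R : A → A → Set} where

  iter-++ : ∀ {m m′ x y z} → Iter R m x y → Iter R m′ y z → Iter R (m + m′) x z
  iter-++ iter0 q = q
  iter-++ (iterS r p) q = iterS r (iter-++ p q)

  star-refl : ∀ {x} → Star R x x
  star-refl = 0 , iter0

  star-trans : ∀ {x y z} → Star R x y → Star R y z → Star R x z
  star-trans (m , p) (m′ , q) = m + m′ , iter-++ p q

  star-single : ∀ {x y} → R x y → Star R x y
  star-single r = 1 , iterS r iter0

  plus-single : ∀ {x y} → R x y → EquivBy R x y
  plus-single r = 0 , iterS r iter0

  plus⇒star : ∀ {x y} → EquivBy R x y → Star R x y
  plus⇒star (m , p) = suc m , p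

  plus-star : ∀ {x y z} → EquivBy R x y → Star R y z → EquivBy R x z
  plus-star (m , p) (m′ , q) = m + m′ , iter-++ p q

  star-plus : ∀ {x y z} → Star R x y → EquivBy R y z → EquivBy R x z
  star-plus {x} {z = z} (m , p) (m′ , q) =
    m + m′ , subst (λ l → Iter R l x z) (ℕ.+-suc m m′) (iter-++ p q)

  plus-trans : ∀ {x y z} → EquivBy R x y → EquivBy R y z → EquivBy R x z
  plus-trans p q = plus-star p (plus⇒star q)

  iter-transport : ∀ {R′ : A → A → Set} (G : A → Set) →
    (∀ {x y} → G x → R x y → G y) → (∀ {x y} → G x → R x y → R′ x y) →
    ∀ {m x y} → G x → Iter R m x y → Iter R′ m x y
  iter-transport G closed conv gx iter0 = iter0
  iter-transport G closed conv gx (iterS r q) =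
    iterS (conv gx r) (iter-transport G closed conv (closed gx r) q)

data Avoiding {A : Set} (R : A → A → Set) (p : A) : A → A → Set where
  stop : ∀ {x} → Avoiding R p x x
  step : ∀ {x y z} → x ≢ p → R x y → Avoiding R p y z → Avoiding R p x z

module _ {A : Set} {R : A → A → Set} where

  avoiding-transport : ∀ {R′ : A → A → Set} (G : A → Set) {p} →
    (∀ {x y} → G x → R x y → G y) → (∀ {x y} → G x → x ≢ p → R x y → R′ x y) →
    ∀ {x y} → G x → Avoiding R p x y → Star R′ x y
  avoiding-transport G closed conv gx stop = star-refl
  avoiding-transport G closed conv gx (step x≢p r q) =
    star-trans (star-single (conv gx x≢p r)) (avoiding-transport G closed conv (closed gx r) q)

  module _ (_≟_ : (x y : A) → Dec (x ≡ y)) where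

    first-visit : ∀ {m x p} → Iter R m x p → Avoiding R p x p
    first-visit iter0 = stop
    first-visit {x = x} {p} (iterS r rest) with x ≟ p
    ... | yes refl = stop
    ... | no x≢p = step x≢p r (first-visit rest)

    after-last-visit : ∀ {p z} → (∀ {y} → R p y → y ≡ z) →
      ∀ {m y x} → Iter R m y x → Avoiding R p y x ⊎ Avoiding R p z x
    after-last-visit p↦z iter0 = inj₁ stop
    after-last-visit {p} p↦z {y = y} (iterS r rest) with after-last-visit p↦z rest
    ... | inj₂ q = inj₂ q
    ... | inj₁ q with y ≟ p
    ...   | yes refl = inj₂ (subst (λ w → Avoiding R p w _) (p↦z r) q)
    ...   | no y≢p = inj₁ (step y≢p r q)

  module _ {k : ℕ} (g : Fin (suc k) → A) (g↝next : ∀ i → EquivBy R (g i) (g (next i))) where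

    walk-forward : ∀ d i j → toℕ i + d ≡ toℕ j → Star R (g i) (g j)
    walk-forward zero i j i+0≡j
      with Fin.toℕ-injective (trans (sym (ℕ.+-identityʳ (toℕ i))) i+0≡j)
    ... | refl = star-refl
    walk-forward (suc d) i j i+d≡j =
      star-trans (plus⇒star (g↝next i)) (walk-forward d (next i) j next-i+d≡j)
      where
      i<k : toℕ i < k
      i<k = ℕ.<-≤-trans (subst (toℕ i <_) i+d≡j (ℕ.m<m+n (toℕ i) ℕ.0<1+n)) (ℕ.≤-pred (Fin.toℕ<n j))
      next-i+d≡j : toℕ (next i) + d ≡ toℕ j
      next-i+d≡j = trans (cong (_+ d) (toℕ-next i i<k)) (trans (sym (ℕ.+-suc (toℕ i) d)) i+d≡j)

    around-cycle : ∀ i j → EquivBy R (g i) (g j)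
    around-cycle i j =
      star-plus (walk-forward (k ∸ toℕ i) i (fromℕ k)
                   (trans (ℕ.m+[n∸m]≡n (ℕ.≤-pred (Fin.toℕ<n i))) (sym (Fin.toℕ-fromℕ k))))
        (plus-star (subst (λ w → EquivBy R (g (fromℕ k)) (g w)) (next-fromℕ k) (g↝next (fromℕ k)))
                   (walk-forward (toℕ j) zero j refl))

  cycle-connected : ∀ {L} (g : Fin L → A) → (∀ i → EquivBy R (g i) (g (next i))) →
                    ∀ i j → EquivBy R (g i) (g j)
  cycle-connected {suc k} = around-cycle

module _ {A : Set} where

  BijectiveOn-resp : ∀ {P Q : A → Set} {R R′ : A → A → Set} →
    (∀ x → P x → Q x) → (∀ x → Q x → P x) →
    (∀ {x y} → P x → R x y → R′ x y) → (∀ {x y} → P x → R′ x y → R x y) →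
    BijectiveOn Q R → BijectiveOn P R′
  BijectiveOn-resp P⇒Q Q⇒P R⇒R′ R′⇒R (fw , bw) =
    (λ x px → let (y , qy , r , uniq) = fw x (P⇒Q x px) in
      y , Q⇒P y qy , R⇒R′ px r , λ y′ r′ → uniq y′ (R′⇒R px r′)) ,
    (λ y py → let (x , qx , r , uniq) = bw y (P⇒Q y py) in
      x , Q⇒P x qx , R⇒R′ (Q⇒P x qx) r , λ x′ px′ r′ → uniq x′ (P⇒Q x′ px′) (R′⇒R px′ r′))

  BijectiveOn-∘ : ∀ {P : A → Set} {R T R′ : A → A → Set} →
    BijectiveOn P R → BijectiveOn P T →
    (∀ {x y} → P x → R′ x y → Σ A λ z → T x z × R z y) →
    (∀ {x y z} → P x → T x z → R z y → R′ x y) →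
    BijectiveOn P R′
  BijectiveOn-∘ {P} {R} {T} {R′} (Rfw , Rbw) (Tfw , Tbw) split join = fw , bw
    where
    fw : ∀ x → P x → Σ A λ y → P y × R′ x y × (∀ y′ → R′ x y′ → y′ ≡ y)
    fw x px with Tfw x px
    ... | z , pz , txz , Tuniq with Rfw z pz
    ...   | y , py , rzy , Runiq = y , py , join px txz rzy , uniq
      where
      uniq : ∀ y′ → R′ x y′ → y′ ≡ y
      uniq y′ r′ with split px r′
      ... | z′ , txz′ , rz′y′ with Tuniq z′ txz′
      ...   | refl = Runiq y′ rz′y′
    bw : ∀ y → P y → Σ A λ x → P x × R′ x y × (∀ x′ → P x′ → R′ x′ y → x′ ≡ x)
    bw y py with Rbw y py
    ... | z , pz , rzy , Runiq with Tbw z pz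
    ...   | x , px , txz , Tuniq = x , px , join px txz rzy , uniq
      where
      uniq : ∀ x′ → P x′ → R′ x′ y → x′ ≡ x
      uniq x′ px′ r′ with split px′ r′
      ... | z′ , txz′ , rz′y with Tfw x′ px′
      ...   | _ , pz″ , _ , Tuniq′ with Tuniq′ z′ txz′
      ...     | refl with Runiq z′ pz″ rz′y
      ...       | refl = Tuniq x′ px′ txz′

T⇒≡true : ∀ {b} → T b → b ≡ true
T⇒≡true = Equivalence.to T-≡

≡true⇒T : ∀ {b} → b ≡ true → T b
≡true⇒T = Equivalence.from T-≡

∧≡true⁻ : ∀ {a b} → a ∧ b ≡ true → a ≡ true × b ≡ true
∧≡true⁻ {true} {true} _ = refl , refl

∧≡true⁺ : ∀ {a b} → a ≡ true → b ≡ true → a ∧ b ≡ true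
∧≡true⁺ refl refl = refl

false≢true : false ≢ true
false≢true ()

anyFin⁺ : ∀ {L} (p : Fin L → Bool) i → p i ≡ true → anyFin p ≡ true
anyFin⁺ p zero pi≡true rewrite pi≡true = refl
anyFin⁺ p (suc i) pi≡true with p zero
... | true = refl
... | false = anyFin⁺ (p ∘ suc) i pi≡true

anyFin⁻ : ∀ {L} (p : Fin L → Bool) → anyFin p ≡ true → Σ (Fin L) λ i → p i ≡ true
anyFin⁻ {suc L} p any≡true with p zero in p0
... | true = zero , p0
... | false with anyFin⁻ (p ∘ suc) any≡true
...   | i , pi≡true = suc i , pi≡true

minOpt-just : ∀ {x y m} → minOpt x y ≡ just m → x ≡ just m ⊎ y ≡ just m
minOpt-just {nothing} e = inj₂ e
minOpt-just {just x} {nothing} e = inj₁ e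
minOpt-just {just x} {just y} refl with ℕ.⊓-sel x y
... | inj₁ e = inj₁ (cong just (sym e))
... | inj₂ e = inj₂ (cong just (sym e))

minOpt-nothing : ∀ {x y} → minOpt x y ≡ nothing → x ≡ nothing × y ≡ nothing
minOpt-nothing {nothing} {nothing} _ = refl , refl
minOpt-nothing {just _} {nothing} ()
minOpt-nothing {just _} {just _} ()

minFin-just : ∀ {L} (f : Fin L → Maybe ℕ) {m} → minFin f ≡ just m → Σ (Fin L) λ i → f i ≡ just m
minFin-just {suc L} f e with minOpt-just {f zero} e
... | inj₁ e′ = zero , e′
... | inj₂ e′ with minFin-just (f ∘ suc) e′
...   | i , fi≡m = suc i , fi≡m

minFin-nothing : ∀ {L} (f : Fin L → Maybe ℕ) → minFin f ≡ nothing → ∀ i → f i ≡ nothing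
minFin-nothing {suc L} f e zero = proj₁ (minOpt-nothing {f zero} e)
minFin-nothing {suc L} f e (suc i) = minFin-nothing (f ∘ suc) (proj₂ (minOpt-nothing {f zero} e)) i

module _ {n : ℕ} where

  findPos-just : ∀ {L} (f : Fin L → Fin n) {v i} → findPos f v ≡ just i → f i ≡ v
  findPos-just {suc L} f {v} e with f zero Fin.≟ v
  findPos-just {suc L} f {i = zero} refl | yes f0≡v = f0≡v
  findPos-just {suc L} f {v} e | no _ with findPos (f ∘ suc) v in eq
  findPos-just {suc L} f {i = suc i} refl | no _ | just i = findPos-just (f ∘ suc) eq

  findPos-nothing : ∀ {L} (f : Fin L → Fin n) {v} → findPos f v ≡ nothing → ∀ i → f i ≢ v
  findPos-nothing {suc L} f {v} e i fi≡v with f zero Fin.≟ v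
  findPos-nothing {suc L} f () i fi≡v | yes _
  findPos-nothing {suc L} f e zero fi≡v | no f0≢v = f0≢v fi≡v
  findPos-nothing {suc L} f {v} e (suc i) fi≡v | no _ with findPos (f ∘ suc) v in eq
  findPos-nothing {suc L} f e (suc i) fi≡v | no _ | nothing = findPos-nothing (f ∘ suc) eq i fi≡v

  findPos-injective : ∀ {L} (f : Fin L → Fin n) → Injective _≡_ _≡_ f → ∀ i → findPos f (f i) ≡ just i
  findPos-injective f f-inj i with findPos f (f i) in eq
  ... | just i′ = cong just (f-inj (findPos-just f eq))
  ... | nothing = ⊥-elim (findPos-nothing f eq i refl)

  -- Edge-disjointness of the cycles found

  EdgeDisjoint : OrdCycle n → OrdCycle n → Set
  EdgeDisjoint C C′ = ∀ e → CEdge C e → ¬ CEdge C′ e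

  SameEdge-euclidean : {e f g : DEdge n} → SameEdge e f → SameEdge e g → SameEdge f g
  SameEdge-euclidean (inj₁ (refl , refl)) (inj₁ (refl , refl)) = inj₁ (refl , refl)
  SameEdge-euclidean (inj₁ (refl , refl)) (inj₂ (refl , refl)) = inj₂ (refl , refl)
  SameEdge-euclidean (inj₂ (refl , refl)) (inj₁ (refl , refl)) = inj₂ (refl , refl)
  SameEdge-euclidean (inj₂ (refl , refl)) (inj₂ (refl , refl)) = inj₁ (refl , refl)

  EintFresh : State n → List (DEdge n) → Set
  EintFresh S es = ∀ x y → Eint S x y → All (λ f → ¬ SameEdge (x , y) f) es

  EintFresh-addEdge : ∀ {S : State n} {e es} → EintFresh S (e ∷ es) →
    AllPairs (λ a b → ¬ SameEdge a b) (e ∷ es) → EintFresh (addEdge e S) es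
  EintFresh-addEdge fresh _ x y (inj₁ xy∈E) with fresh x y xy∈E
  ... | _ ∷ rest = rest
  EintFresh-addEdge fresh (e-new ∷ _) x y (inj₂ xy≈e) =
    All.map (λ xy≉f xy≈f → xy≉f (SameEdge-euclidean xy≈e xy≈f)) e-new

  cycle-edge-source : ∀ {S : State n} {es tr} → Exec S es tr → ∀ x y → OnCycles tr (x , y) →
    Eint S x y ⊎ Any (SameEdge (x , y)) es
  cycle-edge-source (noCyc _ ex) x y on with cycle-edge-source ex x y on
  ... | inj₁ (inj₁ xy∈E) = inj₁ xy∈E
  ... | inj₁ (inj₂ xy≈e) = inj₂ (here xy≈e)
  ... | inj₂ later = inj₂ (there later)
  cycle-edge-source (cyc C ch isC _ ex) x y (here (i , refl , refl)) with isC i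
  ... | inj₁ xy∈E = inj₁ xy∈E
  ... | inj₂ xy≈e = inj₂ (here xy≈e)
  cycle-edge-source (cyc C ch isC _ ex) x y (there on) with cycle-edge-source ex x y on
  ... | inj₁ (inj₁ xy∈E , _) = inj₁ xy∈E
  ... | inj₁ (inj₂ xy≈e , _) = inj₂ (here xy≈e)
  ... | inj₂ later = inj₂ (there later)

  found-cycles-disjoint : ∀ {S : State n} {es tr} → Exec S es tr → EintFresh S es →
    AllPairs (λ a b → ¬ SameEdge a b) es → AllPairs EdgeDisjoint (map proj₁ tr)
  found-cycles-disjoint done fresh distinct = []
  found-cycles-disjoint {S} {e ∷ es} (noCyc _ ex) fresh distinct@(_ ∷ distinct′) =
    found-cycles-disjoint ex (EintFresh-addEdge {S} {e} {es} fresh distinct) distinct′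
  found-cycles-disjoint {S} {e ∷ es} {_ ∷ tr} (cyc C ch isC _ ex) fresh distinct@(e-new ∷ distinct′) =
    All.tabulate disjoint-from-later ∷ found-cycles-disjoint ex fresh′ distinct′
    where
    fresh′ : EintFresh (Merge.merge (addEdge e S) C ch) es
    fresh′ x y xy∈E = EintFresh-addEdge {S} {e} {es} fresh distinct x y (proj₁ xy∈E)
    disjoint-from-later : ∀ {C′} → C′ ∈ map proj₁ tr → EdgeDisjoint C C′
    disjoint-from-later C′∈tr (x , y) onC onC′
      with cycle-edge-source ex x y (Any.map (λ { refl → onC′ }) C′∈tr)
    ... | inj₁ (_ , notC , _) = notC onC
    ... | inj₂ later with onC
    ...   | i , refl , refl with isC i
    ...     | inj₁ xy∈E = All¬⇒¬Any (fresh _ _ xy∈E) (there later)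
    ...     | inj₂ xy≈e =
      All¬⇒¬Any (All.map (λ e≉f xy≈f → e≉f (SameEdge-euclidean xy≈e xy≈f)) e-new) later

  CSucc-source : ∀ {C : OrdCycle n} {x y} → CSucc C x y → CEdge C x
  CSucc-source (i , refl , _) = i , refl , refl

  CSucc-target : ∀ {C : OrdCycle n} {x y} → CSucc C x y → CEdge C y
  CSucc-target (i , _ , refl) = next i , refl , refl

  CSucc-functional : ∀ {C : OrdCycle n} {x y y′} → CSucc C x y → CSucc C x y′ → y ≡ y′
  CSucc-functional {C} (i , refl , refl) (i′ , e , refl) with vtxInj C (proj₁ (×-≡,≡←≡ e))
  ... | refl = refl

  CSucc-injective : ∀ {C : OrdCycle n} {x x′ y} → CSucc C x y → CSucc C x′ y → x ≡ x′
  CSucc-injective {C} (i , refl , refl) (i′ , refl , e) with next-injective (vtxInj C (proj₁ (×-≡,≡←≡ e)))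
  ... | refl = refl

  CSucc-from : ∀ {C : OrdCycle n} {x} → CEdge C x → Σ (DEdge n) (CSucc C x)
  CSucc-from (i , refl , refl) = _ , i , refl , refl

  CSucc-into : ∀ {C : OrdCycle n} {y} → CEdge C y → Σ (DEdge n) λ x → CSucc C x y
  CSucc-into {C} (i , refl , refl) =
    _ , prev i , refl , cong (λ j → vtx C j , vtx C (next j)) (sym (next-prev i))

  OnCycle : List (OrdCycle n) → DEdge n → Set
  OnCycle Cs e = Any (λ C → CEdge C e) Cs

  same-cycle : ∀ {e} {X Y : OrdCycle n → Set} {Cs} → AllPairs EdgeDisjoint Cs →
    Any (λ C → CEdge C e × X C) Cs → Any (λ C → CEdge C e × Y C) Cs → Σ (OrdCycle n) λ C → X C × Y C
  same-cycle _ (here (_ , x)) (here (_ , y)) = _ , x , y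
  same-cycle {e} (disj ∷ _) (here (onC , _)) (there later) =
    ⊥-elim (All¬⇒¬Any (All.map (λ C#C′ onC′ → C#C′ e onC (proj₁ onC′)) disj) later)
  same-cycle {e} (disj ∷ _) (there later) (here (onC , _)) =
    ⊥-elim (All¬⇒¬Any (All.map (λ C#C′ onC′ → C#C′ e onC (proj₁ onC′)) disj) later)
  same-cycle (_ ∷ disj) (there p) (there q) = same-cycle disj p q

  CSucc-from-any : ∀ {x} Cs → OnCycle Cs x → Σ (DEdge n) λ y → Any (λ C → CSucc C x y) Cs
  CSucc-from-any (C ∷ _) (here onC) = let (y , s) = CSucc-from {C} onC in y , here s
  CSucc-from-any (_ ∷ Cs) (there on) = let (y , s) = CSucc-from-any Cs on in y , there s

  CSucc-into-any : ∀ {y} Cs → OnCycle Cs y → Σ (DEdge n) λ x → Any (λ C → CSucc C x y) Cs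
  CSucc-into-any (C ∷ _) (here onC) = let (x , s) = CSucc-into {C} onC in x , here s
  CSucc-into-any (_ ∷ Cs) (there on) = let (x , s) = CSucc-into-any Cs on in x , there s

  DeltaC-bijective : ∀ Cs → AllPairs EdgeDisjoint Cs →
    BijectiveOn (OnCycle Cs) (λ x y → Any (λ C → CSucc C x y) Cs)
  DeltaC-bijective Cs disj = fw , bw
    where
    with-source : ∀ {x y} → Any (λ C → CSucc C x y) Cs → Any (λ C → CEdge C x × CSucc C x y) Cs
    with-source = Any.map (λ {C} s → CSucc-source {C} s , s)
    with-target : ∀ {x y} → Any (λ C → CSucc C x y) Cs → Any (λ C → CEdge C y × CSucc C x y) Cs
    with-target = Any.map (λ {C} s → CSucc-target {C} s , s)
    fw : ∀ x → OnCycle Cs x → Σ (DEdge n) λ y → OnCycle Cs y × Any (λ C → CSucc C x y) Cs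
           × (∀ y′ → Any (λ C → CSucc C x y′) Cs → y′ ≡ y)
    fw x onx with CSucc-from-any Cs onx
    ... | y , s = y , Any.map (λ {C} → CSucc-target {C}) s , s , λ y′ s′ →
      let (C , s₁ , s₂) = same-cycle disj (with-source s′) (with-source s) in CSucc-functional {C} s₁ s₂
    bw : ∀ y → OnCycle Cs y → Σ (DEdge n) λ x → OnCycle Cs x × Any (λ C → CSucc C x y) Cs
           × (∀ x′ → OnCycle Cs x′ → Any (λ C → CSucc C x′ y) Cs → x′ ≡ x)
    bw y ony with CSucc-into-any Cs ony
    ... | x , s = x , Any.map (λ {C} → CSucc-source {C}) s , s , λ x′ _ s′ →
      let (C , s₁ , s₂) = same-cycle disj (with-target s′) (with-target s) in CSucc-injective {C} s₁ s₂

-- The invariant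

Trace : ℕ → Set₁
Trace n = List (OrdCycle n × State n)

module _ {n : ℕ} where

  Edges : Trace n → Trace n → DEdge n → Set
  Edges pst fut e = OnCycles pst e ⊎ OnCycles fut e

  Succ* : Trace n → State n → Trace n → DEdge n → DEdge n → Set
  Succ* pst S fut e e′ = (OnCycles pst e × Delta S e e′) ⊎ (OnCycles fut e × DeltaC fut e e′)

  Delta-head : ∀ {S : State n} {x y} → Delta S x y → proj₁ y ≡ proj₂ x
  Delta-head (v≡v′ , _) = v≡v′

  record Invariant (pst : Trace n) (S : State n) (fut : Trace n) : Set where
    field
      label≤c : ∀ v → t S v ≤ c S
      -- c distinct labelled vertices, so c ≤ |V|: step 2 of Merge-Cycle only considers labels ≤ |V|.
      witness : Fin (c S) → Fin n
      witness-injective : Injective _≡_ _≡_ witness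
      witness-labelled : ∀ l → t S (witness l) ≢ 0
      processed-labelled : ∀ u v → OnCycles pst (u , v) → t S u ≢ 0 × t S u ≡ t S v
      W⇒processed : ∀ x y s → W S x y s → OnCycles pst (x , y)
      F⇒processed : ∀ x y → F S x y → OnCycles pst (x , y)
      F-unique : ∀ x x′ v → F S x v → F S x′ v → x ≡ x′
      F-exists : ∀ v → t S v ≢ 0 → Σ (Fin n) λ x → F S x v
      F⇒unwritten : ∀ x y s → F S x y → ¬ W S x y s
      bijective : BijectiveOn (Edges pst fut) (Succ* pst S fut)
      processed-closed : ∀ x y → OnCycles pst x → Succ* pst S fut x y → OnCycles pst y
      connected : ∀ e e′ → OnCycles pst e → OnCycles pst e′ → t S (proj₁ e) ≡ t S (proj₁ e′) →
                  EquivBy (Succ* pst S fut) e e′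
      processed-not-future : ∀ e → OnCycles pst e → ¬ OnCycles fut e
      future-disjoint : AllPairs EdgeDisjoint (map proj₁ fut)

  record AddsCycle (pst′ pst : Trace n) (C : OrdCycle n) : Set where
    field
      old-or-new : ∀ e → OnCycles pst′ e → OnCycles pst e ⊎ CEdge C e
      old : ∀ e → OnCycles pst e → OnCycles pst′ e
      new : ∀ e → CEdge C e → OnCycles pst′ e

module InvariantProperties {n : ℕ} {pst fut : Trace n} {S : State n} (I : Invariant pst S fut) where

  open Invariant I

  δ-processed : ∀ {x y} → OnCycles pst x → Succ* pst S fut x y → Delta S x y
  δ-processed px (inj₁ (_ , d)) = d
  δ-processed px (inj₂ (fx , _)) = ⊥-elim (processed-not-future _ px fx)

  δ-future : ∀ {x y} → OnCycles fut x → Succ* pst S fut x y → DeltaC fut x y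
  δ-future fx (inj₁ (px , _)) = ⊥-elim (processed-not-future _ px fx)
  δ-future fx (inj₂ (_ , s)) = s

  δ-functional : ∀ {x y y′} → Edges pst fut x → Succ* pst S fut x y → Succ* pst S fut x y′ → y ≡ y′
  δ-functional {x} {y} {y′} ex r r′ with proj₁ bijective x ex
  ... | _ , _ , _ , uniq = trans (uniq y r) (sym (uniq y′ r′))

  δ-total : ∀ x → Edges pst fut x → Σ (DEdge n) λ y → Edges pst fut y × Succ* pst S fut x y
  δ-total x ex with proj₁ bijective x ex
  ... | y , ey , r , _ = y , ey , r

  δ-label : ∀ {x y} → OnCycles pst x → Succ* pst S fut x y → t S (proj₁ y) ≡ t S (proj₁ x)
  δ-label {u , v} px r =
    trans (cong (t S) (Delta-head {S = S} (δ-processed px r))) (sym (proj₂ (processed-labelled u v px)))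

  path-label : ∀ {m x y} → OnCycles pst x → Iter (Succ* pst S fut) m x y → t S (proj₁ y) ≡ t S (proj₁ x)
  path-label px iter0 = refl
  path-label px (iterS r path) = trans (path-label (processed-closed _ _ px r) path) (δ-label px r)

  F-into-labelled : ∀ {x v} → F S x v → t S v ≢ 0
  F-into-labelled {x} {v} f tv≡0 with processed-labelled x v (F⇒processed x v f)
  ... | tx≢0 , tx≡tv = tx≢0 (trans tx≡tv tv≡0)

-- One call of Merge-Cycle preserves the invariant

module MergeStep {n : ℕ} (pst pst′ : Trace n) (S : State n) (C : OrdCycle n)
  (ch : Fin (len C) → Bool) (rest : Trace n) (vj : Merge.ValidJ S C ch)
  (I : Invariant pst S ((C , Merge.merge S C ch) ∷ rest)) (ext : AddsCycle pst′ pst C) where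

  open Merge S C
  open Invariant I
  open InvariantProperties I
  open AddsCycle ext

  S′ : State n
  S′ = merge ch

  fut : Trace n
  fut = (C , S′) ∷ rest

  δ δ′ : DEdge n → DEdge n → Set
  δ = Succ* pst S fut
  δ′ = Succ* pst′ S′ rest

  out into : Fin (len C) → DEdge n
  out i = P i , P (next i)
  into i = P (prev i) , P i

  P-injective : Injective _≡_ _≡_ P
  P-injective = vtxInj C

  out-on-C : ∀ i → CEdge C (out i)
  out-on-C i = i , refl , refl

  into-on-C : ∀ i → CEdge C (into i)
  into-on-C i = prev i , refl , cong P (next-prev i)

  into-next : ∀ i → into (next i) ≡ out i
  into-next i = cong (λ k → P k , P (next i)) (prev-next i)

  into≡out-prev : ∀ i → into i ≡ out (prev i)
  into≡out-prev i = trans (cong into (sym (next-prev i))) (into-next (prev i))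

  into-injective : ∀ {i i′} → into i ≡ into i′ → i ≡ i′
  into-injective e = P-injective (proj₂ (×-≡,≡←≡ e))

  C-unprocessed : ∀ e → CEdge C e → ¬ OnCycles pst e
  C-unprocessed e onC processed = processed-not-future e processed (here onC)

  C-not-later : ∀ e → CEdge C e → ¬ OnCycles rest e
  C-not-later e onC later with future-disjoint
  ... | disj ∷ _ = All¬⇒¬Any (All.map (λ C#C′ → C#C′ e onC) disj) later

  δ-out : ∀ i → δ (out i) (out (next i))
  δ-out i = inj₂ (here (out-on-C i) , here (i , refl , refl))

  δ-into : ∀ i → δ (into i) (out i)
  δ-into i = inj₂ (here (into-on-C i) , here (prev i , cong (λ j → P (prev i) , P j) (sym (next-prev i)) ,
                                              cong (λ j → P j , P (next j)) (sym (next-prev i))))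

  W-off-C : ∀ {x y s} → CEdge C (x , y) → ¬ W S x y s
  W-off-C onC w = C-unprocessed _ onC (W⇒processed _ _ _ w)

  F-off-C : ∀ {x y} → CEdge C (x , y) → ¬ F S x y
  F-off-C onC f = C-unprocessed _ onC (F⇒processed _ _ f)

  c≤n : c S ≤ n
  c≤n = Fin.injective⇒≤ witness-injective

  inRange⁺ : ∀ {x} → 1 ≤ x → x ≤ n → inRange x ≡ true
  inRange⁺ 1≤x x≤n = ∧≡true⁺ (T⇒≡true (ℕ.≤⇒≤ᵇ 1≤x)) (T⇒≡true (ℕ.≤⇒≤ᵇ x≤n))

  inRange⁻ : ∀ {x} → inRange x ≡ true → 1 ≤ x × x ≤ n
  inRange⁻ {x} e with ∧≡true⁻ {1 ≤ᵇ x} e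
  ... | e₁ , e₂ = ℕ.≤ᵇ⇒≤ 1 x (≡true⇒T e₁) , ℕ.≤ᵇ⇒≤ x n (≡true⇒T e₂)

  labelled-inRange : ∀ v → t S v ≢ 0 → inRange (t S v) ≡ true
  labelled-inRange v tv≢0 = inRange⁺ (ℕ.n≢0⇒n>0 tv≢0) (ℕ.≤-trans (label≤c v) c≤n)

  inM⁺ : ∀ {x} i → inRange x ≡ true → t S (P i) ≡ x → inM x ≡ true
  inM⁺ {x} i r e = ∧≡true⁺ r (anyFin⁺ (λ i → t S (P i) ≡ᵇ x) i (T⇒≡true (ℕ.≡⇒≡ᵇ _ _ e)))

  inM⁻ : ∀ {x} → inM x ≡ true → inRange x ≡ true × Σ (Fin (len C)) λ i → t S (P i) ≡ x
  inM⁻ {x} e with ∧≡true⁻ {inRange x} e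
  ... | r , any with anyFin⁻ (λ i → t S (P i) ≡ᵇ x) any
  ...   | i , ti≡x = r , i , ℕ.≡ᵇ⇒≡ _ _ (≡true⇒T ti≡x)

  inM-on-C : ∀ i → t S (P i) ≢ 0 → inM (t S (P i)) ≡ true
  inM-on-C i ti≢0 = inM⁺ i (labelled-inRange (P i) ti≢0) refl

  chosen-labelled : ∀ {i} → ch i ≡ true → t S (P i) ≢ 0
  chosen-labelled {i} chosen ti≡0 = ℕ.<⇒≢ (proj₁ (proj₁ vj i chosen)) (sym ti≡0)

  chosen-unique : ∀ {i i′} → ch i ≡ true → ch i′ ≡ true → t S (P i) ≡ t S (P i′) → i ≡ i′
  chosen-unique {i} {i′} chosen chosen′ same with proj₁ vj i chosen
  ... | 1≤ , ≤n with proj₂ vj i 1≤ ≤n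
  ...   | _ , _ , _ , uniq = trans (uniq i chosen refl) (sym (uniq i′ chosen′ (sym same)))

  chosen-with-label : ∀ {x} → inM x ≡ true → Σ (Fin (len C)) λ i → ch i ≡ true × t S (P i) ≡ x
  chosen-with-label {x} e with inM⁻ e
  ... | r , i₀ , ti₀≡x with inRange⁻ r
  ...   | 1≤x , x≤n with proj₂ vj i₀ (subst (1 ≤_) (sym ti₀≡x) 1≤x) (subst (_≤ n) (sym ti₀≡x) x≤n)
  ...     | i , chosen , ti≡ti₀ , _ = i , chosen , trans ti≡ti₀ ti₀≡x

  labelOnC : Fin (len C) → Maybe ℕ
  labelOnC i = if inRange (t S (P i)) then just (t S (P i)) else nothing

  minM-just : ∀ {m} → minM ≡ just m → inM m ≡ true × m ≤ c S
  minM-just e with minFin-just labelOnC e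
  ... | i , e′ with inRange (t S (P i)) in r
  ...   | true with e′
  ...     | refl = inM⁺ i r refl , label≤c (P i)

  minM-nothing : minM ≡ nothing → ∀ i → t S (P i) ≡ 0
  minM-nothing e i with minFin-nothing labelOnC e i | t S (P i) ℕ.≟ 0
  ... | _ | yes ti≡0 = ti≡0
  ... | e′ | no ti≢0 with inRange (t S (P i)) in r
  ...   | false = ⊥-elim (false≢true (trans (sym r) (labelled-inRange (P i) ti≢0)))
  ...   | true with e′
  ...     | ()

  -- The label a of step 5; it is local to Merge.merge, hence restated.
  a : ℕ
  a with minM
  ... | nothing = suc (c S)
  ... | just m = m

  relabelled : Fin n → Bool
  relabelled v = is-just (findPos P v) ∨ inM (t S v)

  t′≡ : ∀ v → t S′ v ≡ (if relabelled v then a else t S v)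
  t′≡ v with minM
  ... | nothing = refl
  ... | just _ = refl

  a-fresh : minM ≡ nothing → a ≡ suc (c S) × c S′ ≡ suc (c S)
  a-fresh e with minM
  a-fresh refl | nothing = refl , refl

  a-old : ∀ {m} → minM ≡ just m → a ≡ m × c S′ ≡ c S
  a-old e with minM
  a-old refl | just _ = refl , refl

  data LabelView : Set where
    fresh-label : minM ≡ nothing → a ≡ suc (c S) → c S′ ≡ suc (c S) → LabelView
    old-label : ∀ m → minM ≡ just m → a ≡ m → c S′ ≡ c S → LabelView

  label-view : LabelView
  label-view with minM in eq
  ... | nothing = let (a≡ , c′≡) = a-fresh eq in fresh-label eq a≡ c′≡
  ... | just m = let (a≡ , c′≡) = a-old eq in old-label m eq a≡ c′≡

  a≢0 : a ≢ 0
  a≢0 a≡0 with label-view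
  ... | fresh-label _ a≡ _ = ℕ.1+n≢0 (trans (sym a≡) a≡0)
  ... | old-label m e a≡m _ =
    ℕ.<⇒≢ (proj₁ (inRange⁻ (proj₁ (inM⁻ (proj₁ (minM-just e)))))) (sym (trans (sym a≡m) a≡0))

  a≤c′ : a ≤ c S′
  a≤c′ with label-view
  ... | fresh-label _ a≡ c′≡ = ℕ.≤-reflexive (trans a≡ (sym c′≡))
  ... | old-label m e a≡m c′≡ = subst₂ _≤_ (sym a≡m) (sym c′≡) (proj₂ (minM-just e))

  c≤c′ : c S ≤ c S′
  c≤c′ with label-view
  ... | fresh-label _ _ c′≡ = subst (c S ≤_) (sym c′≡) (ℕ.n≤1+n _)
  ... | old-label _ _ _ c′≡ = ℕ.≤-reflexive (sym c′≡)

  -- a is either c + 1 or the least element of M.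
  unmerged-label≢a : ∀ x → x ≤ c S → inM x ≡ false → x ≢ a
  unmerged-label≢a x x≤c x∉M x≡a with label-view
  ... | fresh-label _ a≡ _ = ℕ.n≮n (c S) (subst (_≤ c S) (trans x≡a a≡) x≤c)
  ... | old-label m e a≡m _ =
    false≢true (trans (sym x∉M) (subst (λ k → inM k ≡ true) (sym (trans x≡a a≡m)) (proj₁ (minM-just e))))

  findPos-C : ∀ i → findPos P (P i) ≡ just i
  findPos-C = findPos-injective P P-injective

  t′-on-C : ∀ i → t S′ (P i) ≡ a
  t′-on-C i rewrite t′≡ (P i) | findPos-C i = refl

  t′-labelled : ∀ v → t S v ≢ 0 → t S′ v ≡ (if inM (t S v) then a else t S v)
  t′-labelled v tv≢0 rewrite t′≡ v with findPos P v in eq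
  ... | nothing = refl
  ... | just i with findPos-just P eq
  ...   | refl rewrite inM-on-C i tv≢0 = refl

  t′-stays-labelled : ∀ v → t S v ≢ 0 → t S′ v ≢ 0
  t′-stays-labelled v tv≢0 rewrite t′-labelled v tv≢0 with inM (t S v)
  ... | true = a≢0
  ... | false = tv≢0

  t′-newly-labelled : ∀ v → t S v ≡ 0 → t S′ v ≢ 0 → Σ (Fin (len C)) λ i → P i ≡ v
  t′-newly-labelled v tv≡0 t′v≢0 rewrite t′≡ v with findPos P v in eq
  ... | just i = i , findPos-just P eq
  ... | nothing rewrite tv≡0 = ⊥-elim (t′v≢0 refl)

  j₁-on-C : ∀ i → j₁ (P i) ≡ (if t S (P i) ≡ᵇ 0 then just (P (next i)) else j S (P i))
  j₁-on-C i rewrite findPos-C i = refl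

  j₁-labelled : ∀ i → t S (P i) ≢ 0 → j₁ (P i) ≡ j S (P i)
  j₁-labelled i ti≢0 rewrite j₁-on-C i with t S (P i)
  ... | zero = ⊥-elim (ti≢0 refl)
  ... | suc _ = refl

  j′-on-C : ∀ i → j S′ (P i) ≡ (if ch i then just (P (next i)) else j₁ (P i))
  j′-on-C i rewrite findPos-C i | findPos-C i = refl

  j′-chosen : ∀ i → ch i ≡ true → j S′ (P i) ≡ just (P (next i))
  j′-chosen i chosen rewrite j′-on-C i | chosen = refl

  j′-unlabelled : ∀ i → ch i ≡ false → t S (P i) ≡ 0 → j S′ (P i) ≡ just (P (next i))
  j′-unlabelled i unchosen ti≡0 rewrite j′-on-C i | unchosen | j₁-on-C i | ti≡0 = refl

  j′-unchanged : ∀ v → t S v ≢ 0 → (∀ i → P i ≡ v → ch i ≡ false) → j S′ v ≡ j S v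
  j′-unchanged v tv≢0 unchosen with findPos P v in eq
  ... | nothing rewrite eq = refl
  ... | just i with findPos-just P eq
  ...   | refl rewrite unchosen i refl = j₁-labelled i tv≢0

  FInto : Fin (len C) → DEdge n → Set
  FInto i x = ch i ≡ true × F S (proj₁ x) (P i) × proj₂ x ≡ P i

  Unaffected : DEdge n → Set
  Unaffected x = ∀ i → ch i ≡ true → ¬ FInto i x × x ≢ into i

  FInto-processed : ∀ {i x} → FInto i x → OnCycles pst x
  FInto-processed {i} {u , _} (_ , f , refl) = F⇒processed u (P i) f

  FInto-unique : ∀ {i x x′} → FInto i x → FInto i x′ → x ≡ x′
  FInto-unique {i} {u , _} {u′ , _} (_ , f , refl) (_ , f′ , refl) = cong (_, P i) (F-unique u u′ (P i) f f′)

  FInto-position : ∀ {i i′ x} → FInto i x → FInto i′ x → i ≡ i′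
  FInto-position (_ , _ , e) (_ , _ , e′) = P-injective (trans (sym e) e′)

  FInto-exists : ∀ i → ch i ≡ true → Σ (DEdge n) (FInto i)
  FInto-exists i chosen with F-exists (P i) (chosen-labelled chosen)
  ... | x , f = (x , P i) , chosen , f , refl

  FInto-label : ∀ {i x} → FInto i x → t S (proj₁ x) ≡ t S (P i)
  FInto-label {i} {u , _} (_ , f , refl) = proj₂ (processed-labelled u (P i) (F⇒processed u (P i) f))

  data Kind (x : DEdge n) : Set where
    F-edge : ∀ i → FInto i x → Kind x
    C-edge : ∀ i → ch i ≡ true → x ≡ into i → Kind x
    other : Unaffected x → Kind x

  unchosen-head⇒unaffected : ∀ {u v} → (∀ i → ch i ≡ true → P i ≢ v) → Unaffected (u , v)
  unchosen-head⇒unaffected unchosen i chosen =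
    (λ (_ , _ , v≡) → unchosen i chosen (sym v≡)) , (λ e → unchosen i chosen (sym (proj₂ (×-≡,≡←≡ e))))

  kind : ∀ x → Kind x
  kind (u , v) with findPos P v in eq
  ... | nothing = other (unchosen-head⇒unaffected λ i _ → findPos-nothing P eq i)
  ... | just i with findPos-just P eq | ch i in chi
  ...   | refl | false = other (unchosen-head⇒unaffected λ i′ chosen′ e →
            false≢true (trans (sym chi) (subst (λ k → ch k ≡ true) (P-injective e) chosen′)))
  ...   | refl | true with F-exists (P i) (chosen-labelled chi)
  ...     | x , f with u Fin.≟ x | u Fin.≟ P (prev i)
  ...       | yes refl | _ = F-edge i (chi , f , refl)
  ...       | no _ | yes refl = C-edge i chi refl
  ...       | no u≢x | no u≢prev = other λ i′ _ →
            (λ (_ , f′ , e) →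
               u≢x (F-unique u x (P i) (subst (λ k → F S u (P k)) (sym (P-injective e)) f′) f))
          , (λ e → let (u≡ , Pi≡) = ×-≡,≡←≡ e in
               u≢prev (trans u≡ (cong (P ∘ prev) (sym (P-injective Pi≡)))))

  W′-old : ∀ {x y s} → OnCycles pst (x , y) → W S′ x y s → W S x y s
  W′-old px (inj₁ w) = w
  W′-old px (inj₂ (inj₁ (i , _ , refl , refl , _))) = ⊥-elim (C-unprocessed (into i) (into-on-C i) px)
  W′-old px (inj₂ (inj₂ (i , _ , _ , refl , refl , _))) = ⊥-elim (C-unprocessed (out i) (out-on-C i) px)

  F′-old : ∀ {x y} → OnCycles pst (x , y) → F S′ x y → F S x y
  F′-old px (inj₁ f) = f
  F′-old px (inj₂ (i , _ , refl , refl)) = ⊥-elim (C-unprocessed (into i) (into-on-C i) px)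

  j′-at-unaffected : ∀ {u v} → F S u v → Unaffected (u , v) → j S′ v ≡ j S v
  j′-at-unaffected {u} {v} f unaffected = j′-unchanged v (F-into-labelled f) unchosen
    where
    unchosen : ∀ i → P i ≡ v → ch i ≡ false
    unchosen i refl with ch i in chosen
    ... | false = refl
    ... | true = ⊥-elim (proj₁ (unaffected i chosen) (chosen , f , refl))

  old-unaffected⇒ : ∀ {x y} → OnCycles pst x → Unaffected x → δ′ x y → δ x y
  old-unaffected⇒ {x} px _ (inj₂ (later , _)) = ⊥-elim (processed-not-future x px (there later))
  old-unaffected⇒ px _ (inj₁ (_ , v≡ , inj₁ w)) = inj₁ (px , v≡ , inj₁ (W′-old px w))
  old-unaffected⇒ px unaffected (inj₁ (_ , v≡ , inj₂ (f′ , j≡))) =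
    inj₁ (px , v≡ , inj₂ (f , trans (sym (j′-at-unaffected f unaffected)) j≡))
    where f = F′-old px f′

  old-unaffected⇐ : ∀ {x y} → OnCycles pst x → Unaffected x → δ x y → δ′ x y
  old-unaffected⇐ px unaffected r with δ-processed px r
  ... | v≡ , inj₁ w = inj₁ (old _ px , v≡ , inj₁ (inj₁ w))
  ... | v≡ , inj₂ (f , j≡) = inj₁ (old _ px , v≡ , inj₂ (inj₁ f , trans (j′-at-unaffected f unaffected) j≡))

  later⇒ : ∀ {x y} → OnCycles rest x → δ′ x y → δ x y
  later⇒ {x} later (inj₁ (px′ , _)) with old-or-new x px′
  ... | inj₁ px = ⊥-elim (processed-not-future x px (there later))
  ... | inj₂ onC = ⊥-elim (C-not-later x onC later)
  later⇒ later (inj₂ (_ , s)) = inj₂ (there later , there s)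

  later⇐ : ∀ {x y} → OnCycles rest x → δ x y → δ′ x y
  later⇐ {x} later (inj₁ (px , _)) = ⊥-elim (processed-not-future x px (there later))
  later⇐ {x} later (inj₂ (_ , here s)) = ⊥-elim (C-not-later x (CSucc-source {C = C} s) later)
  later⇐ later (inj₂ (_ , there s)) = inj₂ (later , s)

  δ′-out : ∀ i → ch (next i) ≡ false → δ′ (out i) (out (next i))
  δ′-out i unchosen with t S (P (next i)) ℕ.≟ 0
  ... | yes t≡0 = inj₁ (new _ (out-on-C i) , refl ,
          inj₂ (inj₂ (next i , t≡0 , cong P (sym (prev-next i)) , refl) , j′-unlabelled (next i) unchosen t≡0))
  ... | no t≢0 = inj₁ (new _ (out-on-C i) , refl , inj₁ (inj₂ (inj₂ (i , unchosen , t≢0 , refl , refl , refl))))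

  δ′-out-unique : ∀ i → ch (next i) ≡ false → ∀ {y} → δ′ (out i) y → y ≡ out (next i)
  δ′-out-unique i _ (inj₂ (later , _)) = ⊥-elim (C-not-later _ (out-on-C i) later)
  δ′-out-unique i _ (inj₁ (_ , _ , inj₁ (inj₁ w))) = ⊥-elim (W-off-C (out-on-C i) w)
  δ′-out-unique i unchosen (inj₁ (_ , _ , inj₁ (inj₂ (inj₁ (_ , chosen , _ , e , _))))) with P-injective e
  ... | refl = ⊥-elim (false≢true (trans (sym unchosen) chosen))
  δ′-out-unique i _ (inj₁ (_ , v≡ , inj₁ (inj₂ (inj₂ (_ , _ , _ , e , _ , s≡))))) with P-injective e
  ... | refl = cong₂ _,_ v≡ (just-injective s≡)
  δ′-out-unique i _ (inj₁ (_ , _ , inj₂ (inj₁ f , _))) = ⊥-elim (F-off-C (out-on-C i) f)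
  δ′-out-unique i unchosen (inj₁ (_ , v≡ , inj₂ (inj₂ (_ , t≡0 , _ , e) , j≡))) with P-injective e
  ... | refl = cong₂ _,_ v≡ (just-injective (trans (sym j≡) (j′-unlabelled (next i) unchosen t≡0)))

  δ′-F-edge : ∀ {i x} → FInto i x → δ′ x (out i)
  δ′-F-edge {i} fi@(chosen , f , refl) = inj₁ (old _ (FInto-processed fi) , refl , inj₂ (inj₁ f , j′-chosen i chosen))

  δ′-F-edge-unique : ∀ {i x y} → FInto i x → δ′ x y → y ≡ out i
  δ′-F-edge-unique {x = x} fi (inj₂ (later , _)) = ⊥-elim (processed-not-future x (FInto-processed fi) (there later))
  δ′-F-edge-unique {i} {u , _} {_ , s} fi@(_ , f , refl) (inj₁ (_ , _ , inj₁ w)) =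
    ⊥-elim (F⇒unwritten u (P i) (just s) f (W′-old (FInto-processed fi) w))
  δ′-F-edge-unique {i} fi@(chosen , _ , refl) (inj₁ (_ , v≡ , inj₂ (_ , j≡))) =
    cong₂ _,_ v≡ (just-injective (trans (sym j≡) (j′-chosen i chosen)))

  F-edge⇒ : ∀ {i x y} → FInto i x → δ′ x y → δ (into i) y
  F-edge⇒ {i} fi r rewrite δ′-F-edge-unique fi r = δ-into i

  F-edge⇐ : ∀ {i x y} → FInto i x → δ (into i) y → δ′ x y
  F-edge⇐ {i} fi r rewrite δ-functional (inj₂ (here (into-on-C i))) r (δ-into i) = δ′-F-edge fi

  C-edge⇒ : ∀ {i x y} → FInto i x → δ′ (into i) y → δ x y
  C-edge⇒ {i} _ (inj₂ (later , _)) = ⊥-elim (C-not-later _ (into-on-C i) later)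
  C-edge⇒ {i} _ (inj₁ (_ , _ , inj₁ (inj₁ w))) = ⊥-elim (W-off-C (into-on-C i) w)
  C-edge⇒ {i} fi@(chosen , f , refl) (inj₁ (_ , v≡ , inj₁ (inj₂ (inj₁ (_ , _ , _ , e , s≡)))))
    with P-injective e
  ... | refl =
    inj₁ (FInto-processed fi , v≡ , inj₂ (f , trans (sym (j₁-labelled i (chosen-labelled chosen))) (sym s≡)))
  C-edge⇒ {i} (chosen , _ , refl) (inj₁ (_ , _ , inj₁ (inj₂ (inj₂ (_ , unchosen , _ , _ , e , _)))))
    with P-injective e
  ... | refl = ⊥-elim (false≢true (trans (sym unchosen) chosen))
  C-edge⇒ {i} _ (inj₁ (_ , _ , inj₂ (inj₁ f , _))) = ⊥-elim (F-off-C (into-on-C i) f)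
  C-edge⇒ {i} (chosen , _ , refl) (inj₁ (_ , _ , inj₂ (inj₂ (_ , t≡0 , _ , e) , _))) with P-injective e
  ... | refl = ⊥-elim (chosen-labelled chosen t≡0)

  C-edge⇐ : ∀ {i x y} → FInto i x → δ x y → δ′ (into i) y
  C-edge⇐ {i} {u , _} {_ , s} fi@(chosen , f , refl) r with δ-processed (FInto-processed fi) r
  ... | _ , inj₁ w = ⊥-elim (F⇒unwritten u (P i) (just s) f w)
  ... | v≡ , inj₂ (_ , j≡) = inj₁ (new _ (into-on-C i) , v≡ ,
          inj₁ (inj₂ (inj₁ (i , chosen , refl , refl , trans (sym j≡) (sym (j₁-labelled i (chosen-labelled chosen)))))))

  C-out-unaffected : ∀ i → Unaffected (out i) → ch (next i) ≡ false
  C-out-unaffected i unaffected with ch (next i) in chosen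
  ... | false = refl
  ... | true = ⊥-elim (proj₂ (unaffected (next i) chosen) (sym (into-next i)))

  unaffected⇒ : ∀ {x y} → Edges pst fut x → Unaffected x → δ′ x y → δ x y
  unaffected⇒ (inj₁ px) unaffected r = old-unaffected⇒ px unaffected r
  unaffected⇒ (inj₂ (here (i , refl , refl))) unaffected r
    rewrite δ′-out-unique i (C-out-unaffected i unaffected) r = δ-out i
  unaffected⇒ (inj₂ (there later)) _ r = later⇒ later r

  unaffected⇐ : ∀ {x y} → Edges pst fut x → Unaffected x → δ x y → δ′ x y
  unaffected⇐ (inj₁ px) unaffected r = old-unaffected⇐ px unaffected r
  unaffected⇐ (inj₂ (here (i , refl , refl))) unaffected r
    rewrite δ-functional (inj₂ (here (out-on-C i))) r (δ-out i) = δ′-out i (C-out-unaffected i unaffected)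
  unaffected⇐ (inj₂ (there later)) _ r = later⇐ later r

  -- Merge-Cycle lets the two edges entering each chosen vertex exchange their successors: δ′ = δ ∘ τ.
  data τ : DEdge n → DEdge n → Set where
    F↦C : ∀ {i x z} → FInto i x → z ≡ into i → τ x z
    C↦F : ∀ {i x z} → x ≡ into i → FInto i z → τ x z
    fixed : ∀ {x} → Unaffected x → τ x x

  τ-sym : ∀ {x z} → τ x z → τ z x
  τ-sym (F↦C fi z≡) = C↦F z≡ fi
  τ-sym (C↦F x≡ fi) = F↦C fi x≡
  τ-sym (fixed unaffected) = fixed unaffected

  τ-functional : ∀ {x z z′} → τ x z → τ x z′ → z ≡ z′
  τ-functional (F↦C fi refl) (F↦C fi′ refl) = cong into (FInto-position fi fi′)
  τ-functional (F↦C fi _) (C↦F refl _) = ⊥-elim (C-unprocessed _ (into-on-C _) (FInto-processed fi))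
  τ-functional (F↦C {i} fi _) (fixed unaffected) = ⊥-elim (proj₁ (unaffected i (proj₁ fi)) fi)
  τ-functional (C↦F refl _) (F↦C fi′ _) = ⊥-elim (C-unprocessed _ (into-on-C _) (FInto-processed fi′))
  τ-functional (C↦F x≡ fi) (C↦F x≡′ fi′) with into-injective (trans (sym x≡) x≡′)
  ... | refl = FInto-unique fi fi′
  τ-functional (C↦F {i} x≡ fi) (fixed unaffected) = ⊥-elim (proj₂ (unaffected i (proj₁ fi)) x≡)
  τ-functional (fixed unaffected) (F↦C {i} fi _) = ⊥-elim (proj₁ (unaffected i (proj₁ fi)) fi)
  τ-functional (fixed unaffected) (C↦F {i} x≡ fi) = ⊥-elim (proj₂ (unaffected i (proj₁ fi)) x≡)
  τ-functional (fixed _) (fixed _) = refl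

  τ-total : ∀ x → Edges pst fut x → Σ (DEdge n) λ z → Edges pst fut z × τ x z
  τ-total x ex with kind x
  ... | F-edge i fi = into i , inj₂ (here (into-on-C i)) , F↦C fi refl
  ... | C-edge i chosen x≡ with FInto-exists i chosen
  ...   | z , fi = z , inj₁ (FInto-processed fi) , C↦F x≡ fi
  τ-total x ex | other unaffected = x , ex , fixed unaffected

  τ-bijective : BijectiveOn (Edges pst fut) τ
  τ-bijective = fw , bw
    where
    fw : ∀ x → Edges pst fut x → Σ (DEdge n) λ z → Edges pst fut z × τ x z × (∀ z′ → τ x z′ → z′ ≡ z)
    fw x ex with τ-total x ex
    ... | z , ez , τxz = z , ez , τxz , λ z′ τxz′ → τ-functional τxz′ τxz
    bw : ∀ z → Edges pst fut z →
         Σ (DEdge n) λ x → Edges pst fut x × τ x z × (∀ x′ → Edges pst fut x′ → τ x′ z → x′ ≡ x)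
    bw z ez with τ-total z ez
    ... | x , ex , τzx = x , ex , τ-sym τzx , λ x′ _ τx′z → τ-functional (τ-sym τx′z) τzx

  δ′-split : ∀ {x y} → Edges pst fut x → δ′ x y → Σ (DEdge n) λ z → τ x z × δ z y
  δ′-split {x} ex r with kind x
  ... | F-edge i fi = into i , F↦C fi refl , F-edge⇒ fi r
  ... | C-edge i chosen refl with FInto-exists i chosen
  ...   | z , fi = z , C↦F refl fi , C-edge⇒ fi r
  δ′-split {x} ex r | other unaffected = x , fixed unaffected , unaffected⇒ ex unaffected r

  δ′-join : ∀ {x y z} → Edges pst fut x → τ x z → δ z y → δ′ x y
  δ′-join _ (F↦C fi refl) r = F-edge⇐ fi r
  δ′-join _ (C↦F refl fi) r = C-edge⇐ fi r
  δ′-join ex (fixed unaffected) r = unaffected⇐ ex unaffected r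

  Edges′⇒Edges : ∀ x → Edges pst′ rest x → Edges pst fut x
  Edges′⇒Edges x (inj₁ px′) with old-or-new x px′
  ... | inj₁ px = inj₁ px
  ... | inj₂ onC = inj₂ (here onC)
  Edges′⇒Edges x (inj₂ later) = inj₂ (there later)

  Edges⇒Edges′ : ∀ x → Edges pst fut x → Edges pst′ rest x
  Edges⇒Edges′ x (inj₁ px) = inj₁ (old x px)
  Edges⇒Edges′ x (inj₂ (here onC)) = inj₁ (new x onC)
  Edges⇒Edges′ x (inj₂ (there later)) = inj₂ later

  δ′-bijective : BijectiveOn (Edges pst′ rest) δ′
  δ′-bijective = BijectiveOn-resp Edges′⇒Edges Edges⇒Edges′ (λ _ r → r) (λ _ r → r)
                   (BijectiveOn-∘ bijective τ-bijective δ′-split δ′-join)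

  δ′-processed-closed : ∀ x y → OnCycles pst′ x → δ′ x y → OnCycles pst′ y
  δ′-processed-closed x y px′ r with kind x
  ... | F-edge i fi rewrite δ′-F-edge-unique fi r = new _ (out-on-C i)
  ... | C-edge i chosen refl with FInto-exists i chosen
  ...   | z , fi = old y (processed-closed z y (FInto-processed fi) (C-edge⇒ fi r))
  δ′-processed-closed x y px′ r | other unaffected with old-or-new x px′
  ... | inj₁ px = old y (processed-closed x y px (old-unaffected⇒ px unaffected r))
  ... | inj₂ (i , refl , refl) rewrite δ′-out-unique i (C-out-unaffected i unaffected) r = new _ (out-on-C (next i))

  label≤c′ : ∀ v → t S′ v ≤ c S′
  label≤c′ v rewrite t′≡ v with relabelled v
  ... | true = a≤c′
  ... | false = ℕ.≤-trans (label≤c v) c≤c′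

  LabelledWitness : ℕ → Set
  LabelledWitness k = Σ (Fin k → Fin n) λ w → Injective _≡_ _≡_ w × (∀ l → t S′ (w l) ≢ 0)

  old-witness : LabelledWitness (c S)
  old-witness = witness , witness-injective , λ l → t′-stays-labelled (witness l) (witness-labelled l)

  -- If M = ∅, no vertex of C is labelled yet, so any of them witnesses the new label c + 1.
  extended-witness : minM ≡ nothing → LabelledWitness (suc (c S))
  extended-witness e = w , w-injective , w-labelled
    where
    v₀ : Fin n
    v₀ = P (fromℕ< (ℕ.≤-trans (s≤s z≤n) (len≥3 C)))
    v₀-unlabelled : t S v₀ ≡ 0
    v₀-unlabelled = minM-nothing e _
    w : Fin (suc (c S)) → Fin n
    w zero = v₀
    w (suc l) = witness l
    w-injective : Injective _≡_ _≡_ w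
    w-injective {zero} {zero} _ = refl
    w-injective {zero} {suc l} e = ⊥-elim (witness-labelled l (subst (λ v → t S v ≡ 0) e v₀-unlabelled))
    w-injective {suc l} {zero} e = ⊥-elim (witness-labelled l (subst (λ v → t S v ≡ 0) (sym e) v₀-unlabelled))
    w-injective {suc l} {suc l′} e = cong suc (witness-injective e)
    w-labelled : ∀ l → t S′ (w l) ≢ 0
    w-labelled zero = subst (_≢ 0) (sym (t′-on-C _)) a≢0
    w-labelled (suc l) = proj₂ (proj₂ old-witness) l

  witness′ : LabelledWitness (c S′)
  witness′ with label-view
  ... | fresh-label e _ c′≡ rewrite c′≡ = extended-witness e
  ... | old-label _ _ _ c′≡ rewrite c′≡ = old-witness

  processed-labelled′ : ∀ u v → OnCycles pst′ (u , v) → t S′ u ≢ 0 × t S′ u ≡ t S′ v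
  processed-labelled′ u v px′ with old-or-new _ px′
  ... | inj₁ px with processed-labelled u v px
  ...   | tu≢0 , tu≡tv = t′-stays-labelled u tu≢0 , (begin
          t S′ u                                   ≡⟨ t′-labelled u tu≢0 ⟩
          (if inM (t S u) then a else t S u)        ≡⟨ cong (λ k → if inM k then a else k) tu≡tv ⟩
          (if inM (t S v) then a else t S v)        ≡⟨ t′-labelled v (λ tv≡0 → tu≢0 (trans tu≡tv tv≡0)) ⟨
          t S′ v                                   ∎)
    where open ≡-Reasoning
  processed-labelled′ u v px′ | inj₂ (i , refl , refl) =
    subst (_≢ 0) (sym (t′-on-C i)) a≢0 , trans (t′-on-C i) (sym (t′-on-C (next i)))

  W′⇒processed : ∀ x y s → W S′ x y s → OnCycles pst′ (x , y)
  W′⇒processed x y s (inj₁ w) = old _ (W⇒processed x y s w)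
  W′⇒processed x y s (inj₂ (inj₁ (i , _ , refl , refl , _))) = new _ (into-on-C i)
  W′⇒processed x y s (inj₂ (inj₂ (i , _ , _ , refl , refl , _))) = new _ (out-on-C i)

  F′⇒processed : ∀ x y → F S′ x y → OnCycles pst′ (x , y)
  F′⇒processed x y (inj₁ f) = old _ (F⇒processed x y f)
  F′⇒processed x y (inj₂ (i , _ , refl , refl)) = new _ (into-on-C i)

  F′-unique : ∀ x x′ v → F S′ x v → F S′ x′ v → x ≡ x′
  F′-unique x x′ v (inj₁ f) (inj₁ f′) = F-unique x x′ v f f′
  F′-unique x x′ v (inj₁ f) (inj₂ (_ , t≡0 , _ , refl)) = ⊥-elim (F-into-labelled f t≡0)
  F′-unique x x′ v (inj₂ (_ , t≡0 , _ , refl)) (inj₁ f′) = ⊥-elim (F-into-labelled f′ t≡0)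
  F′-unique x x′ v (inj₂ (_ , _ , refl , refl)) (inj₂ (_ , _ , refl , e)) with P-injective e
  ... | refl = refl

  F′-exists : ∀ v → t S′ v ≢ 0 → Σ (Fin n) λ x → F S′ x v
  F′-exists v t′v≢0 with t S v ℕ.≟ 0
  ... | no tv≢0 = let (x , f) = F-exists v tv≢0 in x , inj₁ f
  ... | yes tv≡0 with t′-newly-labelled v tv≡0 t′v≢0
  ...   | i , refl = P (prev i) , inj₂ (i , tv≡0 , refl , refl)

  F′⇒unwritten : ∀ x y s → F S′ x y → ¬ W S′ x y s
  F′⇒unwritten x y s (inj₁ f) (inj₁ w) = F⇒unwritten x y s f w
  F′⇒unwritten x y s (inj₁ f) (inj₂ (inj₁ (i , _ , refl , refl , _))) = F-off-C (into-on-C i) f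
  F′⇒unwritten x y s (inj₁ f) (inj₂ (inj₂ (i , _ , _ , refl , refl , _))) = F-off-C (out-on-C i) f
  F′⇒unwritten x y s (inj₂ (i , _ , refl , refl)) (inj₁ w) = W-off-C (into-on-C i) w
  F′⇒unwritten x y s (inj₂ (_ , t≡0 , refl , refl)) (inj₂ (inj₁ (_ , chosen , _ , e , _))) with P-injective e
  ... | refl = chosen-labelled chosen t≡0
  F′⇒unwritten x y s (inj₂ (_ , t≡0 , refl , refl)) (inj₂ (inj₂ (_ , _ , t≢0 , _ , e , _))) with P-injective e
  ... | refl = t≢0 t≡0

  processed-not-future′ : ∀ e → OnCycles pst′ e → ¬ OnCycles rest e
  processed-not-future′ e px′ later with old-or-new e px′
  ... | inj₁ px = processed-not-future e px (there later)
  ... | inj₂ onC = C-not-later e onC later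

  future-disjoint′ : AllPairs EdgeDisjoint (map proj₁ rest)
  future-disjoint′ with future-disjoint
  ... | _ ∷ disj = disj

  InClass : ℕ → DEdge n → Set
  InClass β x = OnCycles pst x × t S (proj₁ x) ≡ β

  InClass-closed : ∀ β {x y} → InClass β x → δ x y → InClass β y
  InClass-closed β (px , tx≡β) r = processed-closed _ _ px r , trans (δ-label px r) tx≡β

  class-of-chosen-unaffected : ∀ {i a x} → FInto i a → InClass (t S (P i)) x → x ≢ a → Unaffected x
  class-of-chosen-unaffected {i} {a} {x} fi (px , tx≡) x≢a i′ chosen′ =
    (λ fi′ → x≢a (FInto-unique fi′ (subst (λ k → FInto k a) (sym (same-position fi′)) fi))) ,
    (λ x≡ → C-unprocessed x (subst (CEdge C) (sym x≡) (into-on-C i′)) px)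
    where
    same-position : FInto i′ x → i′ ≡ i
    same-position fi′ = chosen-unique chosen′ (proj₁ fi) (trans (sym (FInto-label fi′)) tx≡)

  unmerged-class-unaffected : ∀ {β x} → inM β ≡ false → InClass β x → Unaffected x
  unmerged-class-unaffected {β} β∉M (px , tx≡β) i chosen =
    (λ fi → let ti≡β = trans (sym (FInto-label fi)) tx≡β in
      false≢true (trans (sym β∉M)
        (inM⁺ i (subst (λ k → inRange k ≡ true) ti≡β (labelled-inRange (P i) (chosen-labelled chosen))) ti≡β))) ,
    (λ x≡ → C-unprocessed _ (subst (CEdge C) (sym x≡) (into-on-C i)) px)

  avoiding⇒δ′ : ∀ {i a x y} → FInto i a → InClass (t S (P i)) x → Avoiding δ a x y → Star δ′ x y
  avoiding⇒δ′ fi = avoiding-transport (InClass _) (InClass-closed _)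
    (λ inx x≢a r → unaffected⇐ (inj₁ (proj₁ inx)) (class-of-chosen-unaffected fi inx x≢a) r)

  δ-after-F-edge : ∀ {i a} → FInto i a → Σ (DEdge n) λ z → δ a z × InClass (t S (P i)) z
  δ-after-F-edge fi with δ-total _ (inj₁ (FInto-processed fi))
  ... | z , _ , r = z , r , InClass-closed _ (FInto-processed fi , FInto-label fi) r

  -- If v_{i+1} is chosen with F-edge a into it, δ′ leads from (v_i, v_{i+1}) through δ(a) along
  -- the old class of a (which returns to a without meeting it earlier) to a, and then to (v_{i+1}, v_{i+2}).
  δ′-along-C : ∀ i → EquivBy δ′ (out i) (out (next i))
  δ′-along-C i with ch (next i) in chosen
  ... | false = plus-single (δ′-out i chosen)
  ... | true with FInto-exists (next i) chosen
  ...   | a , fi with δ-after-F-edge fi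
  ...     | z , r , inz@(pz , tz≡) with connected z a pz (FInto-processed fi) (trans tz≡ (sym (FInto-label fi)))
  ...       | _ , path = plus-star (plus-single (subst (λ e → δ′ e z) (into-next i) (C-edge⇐ fi r)))
                           (star-trans (avoiding⇒δ′ fi inz (first-visit _≟E_ path)) (star-single (δ′-F-edge fi)))

  C-connected : ∀ i j → EquivBy δ′ (out i) (out j)
  C-connected = cycle-connected out δ′-along-C

  Merged : DEdge n → Set
  Merged x = CEdge C x ⊎ (OnCycles pst x × inM (t S (proj₁ x)) ≡ true)

  i₀ : Fin (len C)
  i₀ = fromℕ< (ℕ.≤-trans (s≤s z≤n) (len≥3 C))

  merged⇒C : ∀ x → Merged x → EquivBy δ′ x (out i₀)
  merged⇒C x (inj₁ (i , refl , refl)) = C-connected i i₀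
  merged⇒C x (inj₂ (px , tx∈M)) with chosen-with-label tx∈M
  ... | i , chosen , ti≡ with FInto-exists i chosen
  ...   | a , fi with connected x a px (FInto-processed fi) (trans (sym ti≡) (sym (FInto-label fi)))
  ...     | _ , path = star-plus (avoiding⇒δ′ fi (px , sym ti≡) (first-visit _≟E_ path))
                         (plus-trans (plus-single (δ′-F-edge fi)) (C-connected i i₀))

  C⇒merged : ∀ x → Merged x → EquivBy δ′ (out i₀) x
  C⇒merged x (inj₁ (i , refl , refl)) = C-connected i₀ i
  C⇒merged x (inj₂ (px , tx∈M)) with chosen-with-label tx∈M
  ... | i , chosen , ti≡ with FInto-exists i chosen
  ...   | a , fi with δ-after-F-edge fi
  ...     | z , r , inz@(pz , tz≡) with connected z x pz px (trans tz≡ ti≡)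
  ...       | _ , path = plus-trans (C-connected i₀ (prev i))
                 (plus-star (plus-single (subst (λ e → δ′ e z) (into≡out-prev i) (C-edge⇐ fi r))) z↝x)
    where
    z↝x : Star δ′ z x
    z↝x with after-last-visit _≟E_ (λ r′ → δ-functional (inj₁ (FInto-processed fi)) r′ r) path
    ... | inj₁ q = avoiding⇒δ′ fi inz q
    ... | inj₂ q = avoiding⇒δ′ fi inz q

  t′-merged : ∀ x → Merged x → t S′ (proj₁ x) ≡ a
  t′-merged x (inj₁ (i , refl , refl)) = t′-on-C i
  t′-merged (u , v) (inj₂ (px , tu∈M)) rewrite t′-labelled u (proj₁ (processed-labelled u v px)) | tu∈M = refl

  t′-unmerged : ∀ x → OnCycles pst x → inM (t S (proj₁ x)) ≡ false → t S′ (proj₁ x) ≡ t S (proj₁ x)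
  t′-unmerged (u , v) px tu∉M rewrite t′-labelled u (proj₁ (processed-labelled u v px)) | tu∉M = refl

  merged-or-not : ∀ x → OnCycles pst′ x → Merged x ⊎ (OnCycles pst x × inM (t S (proj₁ x)) ≡ false)
  merged-or-not x px′ with old-or-new x px′
  ... | inj₂ onC = inj₁ (inj₁ onC)
  ... | inj₁ px with inM (t S (proj₁ x))
  ...   | true = inj₁ (inj₂ (px , refl))
  ...   | false = inj₂ (px , refl)

  connected′ : ∀ e e′ → OnCycles pst′ e → OnCycles pst′ e′ → t S′ (proj₁ e) ≡ t S′ (proj₁ e′) → EquivBy δ′ e e′
  connected′ e e′ pe pe′ same with merged-or-not e pe | merged-or-not e′ pe′
  ... | inj₁ me | inj₁ me′ = plus-trans (merged⇒C e me) (C⇒merged e′ me′)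
  ... | inj₁ me | inj₂ (px′ , ∉M′) = ⊥-elim (unmerged-label≢a _ (label≤c (proj₁ e′)) ∉M′
          (trans (sym (t′-unmerged e′ px′ ∉M′)) (trans (sym same) (t′-merged e me))))
  ... | inj₂ (px , ∉M) | inj₁ me′ = ⊥-elim (unmerged-label≢a _ (label≤c (proj₁ e)) ∉M
          (trans (sym (t′-unmerged e px ∉M)) (trans same (t′-merged e′ me′))))
  ... | inj₂ (px , ∉M) | inj₂ (px′ , ∉M′)
    with connected e e′ px px′ (trans (sym (t′-unmerged e px ∉M)) (trans same (t′-unmerged e′ px′ ∉M′)))
  ...   | m , path = m , iter-transport (InClass (t S (proj₁ e))) (InClass-closed _)
                           (λ inx r → unaffected⇐ (inj₁ (proj₁ inx)) (unmerged-class-unaffected ∉M inx) r)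
                           (px , refl) path

  invariant′ : Invariant pst′ S′ rest
  invariant′ = record
    { label≤c = label≤c′
    ; witness = proj₁ witness′
    ; witness-injective = proj₁ (proj₂ witness′)
    ; witness-labelled = proj₂ (proj₂ witness′)
    ; processed-labelled = processed-labelled′
    ; W⇒processed = W′⇒processed
    ; F⇒processed = F′⇒processed
    ; F-unique = F′-unique
    ; F-exists = F′-exists
    ; F⇒unwritten = F′⇒unwritten
    ; bijective = δ′-bijective
    ; processed-closed = δ′-processed-closed
    ; connected = connected′
    ; processed-not-future = processed-not-future′
    ; future-disjoint = future-disjoint′
    }

module _ {n : ℕ} where

  Invariant-addEdge : ∀ {pst fut} {S : State n} e → Invariant pst S fut → Invariant pst (addEdge e S) fut
  Invariant-addEdge e I = record { Invariant I }

  AddsCycle-snoc : ∀ (pst : Trace n) x → AddsCycle (pst ++ x ∷ []) pst (proj₁ x)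
  AddsCycle-snoc pst x = record
    { old-or-new = λ e on →
        map₂ last-cycle (Any.++⁻ (map proj₁ pst) (subst (Any _) (map-++ proj₁ pst (x ∷ [])) on))
    ; old = λ e on → subst (Any _) (sym (map-++ proj₁ pst (x ∷ []))) (Any.++⁺ˡ on)
    ; new = λ e onC → subst (Any _) (sym (map-++ proj₁ pst (x ∷ []))) (Any.++⁺ʳ (map proj₁ pst) (here onC))
    }
    where
    last-cycle : ∀ {e} → OnCycles (x ∷ []) e → CEdge (proj₁ x) e
    last-cycle (here onC) = onC

  invariant-init : ∀ (tr : Trace n) → AllPairs EdgeDisjoint (map proj₁ tr) → Invariant [] (initState n) tr
  invariant-init tr disj = record
    { label≤c = λ _ → z≤n
    ; witness = λ ()
    ; witness-injective = λ {x} → ⊥-elim (Fin.¬Fin0 x)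
    ; witness-labelled = λ ()
    ; processed-labelled = λ _ _ ()
    ; W⇒processed = λ _ _ _ ()
    ; F⇒processed = λ _ _ ()
    ; F-unique = λ _ _ _ ()
    ; F-exists = λ _ 0≢0 → ⊥-elim (0≢0 refl)
    ; F⇒unwritten = λ _ _ _ ()
    ; bijective = BijectiveOn-resp (λ { _ (inj₁ ()) ; _ (inj₂ on) → on }) (λ _ → inj₂)
                    (λ { (inj₁ ()) ; (inj₂ on) s → inj₂ (on , s) })
                    (λ { _ (inj₁ (() , _)) ; _ (inj₂ (_ , s)) → s })
                    (DeltaC-bijective (map proj₁ tr) disj)
    ; processed-closed = λ _ _ ()
    ; connected = λ _ _ ()
    ; processed-not-future = λ _ ()
    ; future-disjoint = disj
    }

  invariant-step : ∀ {pst} {S : State n} {es C S′ rest} →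
    Invariant pst S ((C , S′) ∷ rest) → Exec S es ((C , S′) ∷ rest) →
    Σ (List (DEdge n)) λ es′ → Exec S′ es′ rest × Invariant (pst ++ (C , S′) ∷ []) S′ rest
  invariant-step I (noCyc {e = e} _ ex) = invariant-step (Invariant-addEdge e I) ex
  invariant-step {pst} {S} {e ∷ es} I (cyc C ch _ vj ex) =
    es , ex , MergeStep.invariant′ pst _ (addEdge e S) C ch _ vj (Invariant-addEdge e I) (AddsCycle-snoc pst _)

  invariant-after : ∀ k (pst : Trace n) (S : State n) tr {es} → Exec S es tr → Invariant pst S tr →
    k ≤ length tr → Invariant (pst ++ take k tr) (stateAt S tr k) (drop k tr)
  invariant-after zero pst S [] _ I _ = subst (λ p → Invariant p S []) (sym (++-identityʳ pst)) I
  invariant-after zero pst S (x ∷ tr) _ I _ = subst (λ p → Invariant p S (x ∷ tr)) (sym (++-identityʳ pst)) I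
  invariant-after (suc k) pst S ((C , S′) ∷ tr) ex I (s≤s k≤) with invariant-step I ex
  ... | _ , ex′ , I′ = subst (λ p → Invariant p (stateAt S′ tr k) (drop k tr))
          (++-assoc pst ((C , S′) ∷ []) (take k tr))
          (invariant-after k (pst ++ (C , S′) ∷ []) S′ tr ex′ I′ k≤)

  map-take++drop : ∀ k (tr : Trace n) → map proj₁ tr ≡ map proj₁ (take k tr) ++ map proj₁ (drop k tr)
  map-take++drop k tr = trans (cong (map proj₁) (sym (take++drop≡id k tr))) (map-++ proj₁ (take k tr) (drop k tr))

  Any-take-drop⁻ : ∀ {P : OrdCycle n → Set} k (tr : Trace n) →
    Any P (map proj₁ tr) → Any P (map proj₁ (take k tr)) ⊎ Any P (map proj₁ (drop k tr))
  Any-take-drop⁻ k tr p = Any.++⁻ (map proj₁ (take k tr)) (subst (Any _) (map-take++drop k tr) p)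

  Any-take⁺ : ∀ {P : OrdCycle n → Set} k (tr : Trace n) → Any P (map proj₁ (take k tr)) → Any P (map proj₁ tr)
  Any-take⁺ k tr p = subst (Any _) (sym (map-take++drop k tr)) (Any.++⁺ˡ p)

  Any-drop⁺ : ∀ {P : OrdCycle n → Set} k (tr : Trace n) → Any P (map proj₁ (drop k tr)) → Any P (map proj₁ tr)
  Any-drop⁺ k tr p = subst (Any _) (sym (map-take++drop k tr)) (Any.++⁺ʳ (map proj₁ (take k tr)) p)

module AfterStep {n : ℕ} (tr : Trace n) (k : ℕ) (S : State n) (I : Invariant (take k tr) S (drop k tr)) where

  open Invariant I
  open InvariantProperties I

  δ* : DEdge n → DEdge n → Set
  δ* = Succ* (take k tr) S (drop k tr)

  edge-split : ∀ x → RStar tr x → Edges (take k tr) (drop k tr) x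
  edge-split x = Any-take-drop⁻ k tr

  edge-join : ∀ x → Edges (take k tr) (drop k tr) x → RStar tr x
  edge-join x (inj₁ px) = Any-take⁺ k tr px
  edge-join x (inj₂ fx) = Any-drop⁺ k tr fx

  δ*-bijective : BijectiveOn (RStar tr) δ*
  δ*-bijective = BijectiveOn-resp edge-split edge-join (λ _ r → r) (λ _ r → r) bijective

  DeltaC-future : ∀ {x y} → OnCycles (drop k tr) x → DeltaC tr x y → DeltaC (drop k tr) x y
  DeltaC-future {x} fx s with Any-take-drop⁻ k tr s
  ... | inj₁ s-past = ⊥-elim (processed-not-future x (Any.map (λ {C} → CSucc-source {C = C}) s-past) fx)
  ... | inj₂ s-future = s-future

  future-closed : ∀ {x y} → OnCycles (drop k tr) x → DeltaC (drop k tr) x y → OnCycles (drop k tr) y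
  future-closed fx s = Any.map (λ {C} → CSucc-target {C = C}) s

  processed-equiv⇔label : ∀ {x x′} → OnCycles (take k tr) x → OnCycles (take k tr) x′ →
    EquivBy δ* x x′ ⇔ (t S (proj₁ x) ≡ t S (proj₁ x′))
  processed-equiv⇔label px px′ = mk⇔ (λ (_ , path) → sym (path-label px path)) (connected _ _ px px′)

  unlabelled-future : ∀ u v → RStar tr (u , v) → t S u ≡ 0 → OnCycles (drop k tr) (u , v)
  unlabelled-future u v on tu≡0 with Any-take-drop⁻ k tr on
  ... | inj₁ px = ⊥-elim (proj₁ (processed-labelled u v px) tu≡0)
  ... | inj₂ fx = fx

  future-equiv⇔cycle-equiv : ∀ {x x′} → OnCycles (drop k tr) x → EquivBy δ* x x′ ⇔ EquivBy (DeltaC tr) x x′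
  future-equiv⇔cycle-equiv fx = mk⇔
    (λ (m , path) → m , iter-transport (OnCycles (drop k tr))
                          (λ fx r → future-closed fx (δ-future fx r))
                          (λ fx r → Any-drop⁺ k tr (δ-future fx r)) fx path)
    (λ (m , path) → m , iter-transport (OnCycles (drop k tr))
                          (λ fx s → future-closed fx (DeltaC-future fx s))
                          (λ fx s → inj₂ (fx , DeltaC-future fx s)) fx path)

lemma8 : (n : ℕ) (es : List (DEdge n)) → SimpleStream es →
           (∀ v → 2 ∣ deg v es) →
           (tr : List (OrdCycle n × State n)) → Exec (initState n) es tr →
           (k : ℕ) → k ≤ length tr →
           BijectiveOn (RStar tr) (DeltaStar (initState n) tr k)
           × (∀ u v u' v' → RStar tr (u , v) → RStar tr (u' , v') →
               Processed tr k (u , v) → Processed tr k (u' , v') →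
               (EquivBy (DeltaStar (initState n) tr k) (u , v) (u' , v')
                 ⇔ (t (stateAt (initState n) tr k) u ≡ t (stateAt (initState n) tr k) u')))
           × (∀ u v → RStar tr (u , v) → Processed tr k (u , v) →
               t (stateAt (initState n) tr k) u ≡ t (stateAt (initState n) tr k) v)
           × (∀ u v u' v' → RStar tr (u , v) → RStar tr (u' , v') →
               t (stateAt (initState n) tr k) u ≡ 0 →
               (EquivBy (DeltaStar (initState n) tr k) (u , v) (u' , v')
                 ⇔ EquivBy (DeltaC tr) (u , v) (u' , v')))
lemma8 n es (_ , distinct) _ tr ex k k≤ =
    δ*-bijective
  , (λ _ _ _ _ _ _ → processed-equiv⇔label)
  , (λ u v _ px → proj₂ (processed-labelled u v px))
  , (λ u v _ _ on _ tu≡0 → future-equiv⇔cycle-equiv (unlabelled-future u v on tu≡0))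
  where
  I : Invariant (take k tr) (stateAt (initState n) tr k) (drop k tr)
  I = invariant-after k [] (initState n) tr ex
        (invariant-init tr (found-cycles-disjoint ex (λ _ _ ()) distinct)) k≤
  open AfterStep tr k (stateAt (initState n) tr k) I
  open Invariant I
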